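{- Let $s,k\geq 2$ be integers, $K\geq 1$ real, and $1\leq \ell_1,\dots,\ell_s\leq k$ integers; put $\ell=\ell_1+\dots+\ell_s$. There is $L_0=L_0(s,k,K)$ such that for every real $L\geq L_0$ the following holds. Let $G$ be a $K$-almost-regular graph on $n$ vertices with minimum degree $\delta$, and suppose $G$ contains at least $\frac{n\delta^{\ell}}{L}$ spiders with length vector $(\ell_1,\dots,\ell_s)$ which are $L$-admissible but not $L$-good. Then there exists a non-empty set $\mathcal{S}$ of $L$-admissible spiders with length vector $(\ell_1,\dots,\ell_s)$ such that: (i) for every $S\in\mathcal{S}$, the number of $T\in\mathcal{S}$ with the same leaf vector as $S$ is at least $\frac{f(\ell,L)}{2}$; (ii) for every $S\in\mathcal{S}$ and every $\gamma_1,\dots,\gamma_s\in\{0,1\}$, the subspider of $S$ with length vector $(\ell_1-\gamma_1,\dots,\ell_s-\gamma_s)$ (a generalised spider) is contained as a subspider in at least $\frac{\delta^{\gamma_1+\dots+\gamma_s}}{L^2}$ elements of $\mathcal{S}$.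
   Context: All notions are relative to the host graph $G$ and fixed integers $s,k\geq 2$. A graph is $K$-almost-regular if its maximum degree is at most $K$ times its minimum degree. Spiders: for positive integers $\ell_1,\dots,\ell_s$, an $s$-legged spider with length vector $(\ell_1,\dots,\ell_s)$ consists of a vertex $u$ (the centre) and paths $P_1,\dots,P_s$ (the legs) of lengths $\ell_1,\dots,\ell_s$, each starting at $u$, pairwise sharing no vertex other than $u$. If $v_i$ is the endpoint of $P_i$ other than $u$, its leaf vector is $(v_1,\dots,v_s)$. Spiders are ordered tuples of legs: $S\neq S'$ if $P_i\neq P'_i$ for some $i$. A generalised spider is defined in the same way but allowing nonnegative leg lengths (a leg of length 0 consists of $u$ alone, whose endpoint is $u$). $S'$ is a subspider of $S$ if they have the same centre and for each $i$ the $i$th leg of $S'$ is a subpath of the $i$th leg of $S$ (starting at the centre). Define $f(1,L)=L$ and for $2\leq \ell\leq sk$, $f(\ell,L)=1+f(\ell-1,L)^{16}(\ell-1)^2\max_{1\leq i\leq \ell-1}f(i,L)f(\ell-i,L)$. $L$-admissible and $L$-good paths (recursively): every path of length 1 is both. For $2\leq \ell\leq k$, a path of length $\ell$ is $L$-admissible if each of its proper subpaths is $L$-good, and $L$-good if it is $L$-admissible and the number of $L$-admissible paths of length $\ell$ between its endpoints is at most $f(\ell,L)$. $L$-admissible and $L$-good spiders: every spider with length vector $(1,\dots,1)$ is $L$-admissible. For $1\leq\ell_1,\dots,\ell_s\leq k$ not all equal to 1, a spider with centre $u$ and legs $P_i=uw_{i,1}\dots w_{i,\ell_i}$ is $L$-admissible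 if (a) for every $i$ and every $1\leq j<\ell_i$, the spider with centre $u$ and legs $P_1,\dots,P_{i-1},uw_{i,1}\dots w_{i,j},P_{i+1},\dots,P_s$ is $L$-good, and (b) every leg $P_i$ is an $L$-good path. A spider with length vector $(\ell_1,\dots,\ell_s)$ and leaf vector $(v_1,\dots,v_s)$ is $L$-good if it is $L$-admissible and the number of $L$-admissible spiders with length vector $(\ell_1,\dots,\ell_s)$ and leaf vector $(v_1,\dots,v_s)$ is at most $f(\ell_1+\dots+\ell_s,L)$.
   Formalization: The parameters K and L are taken in the rationals instead of the reals. -}

module Defs where

open import Data.Bool using (Bool; true; false; _∧_; _∨_; not; if_then_else_)
open import Data.Nat as ℕ using (ℕ; zero; suc; _∸_)
import Data.Nat.Properties as ℕP
open import Data.Fin using (Fin; opposite)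
import Data.Fin.Properties as FinP
open import Data.Integer using (+_)
open import Data.Rational using (ℚ; _/_; _≤ᵇ_; _⊔_; _+_; _*_; 1ℚ)
open import Data.List as List using (List; []; _∷_; length; map; concatMap; allFin; filterᵇ; take; upTo)
open import Data.Bool.ListAction using (and) renaming (all to allᵇ; any to anyᵇ)
open import Data.Vec as Vec using (Vec; []; _∷_; lookup; foldr₁; tabulate; _∷ʳ_)
import Data.Vec.Properties as VecP
open import Data.Maybe using (Maybe; just; nothing)
import Data.Maybe.Properties as MaybeP
open import Data.Product using (_×_; _,_; proj₁; proj₂)
open import Relation.Nullary using (does)
open import Relation.Binary.PropositionalEquality using (_≡_)

ι : ℕ → ℚ
ι n = + n / 1

count : ∀ {A : Set} → (A → Bool) → List A → ℕ
count p xs = length (filterᵇ p xs)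

allLists : (n m : ℕ) → List (List (Fin n))
allLists n zero    = [] ∷ []
allLists n (suc m) = concatMap (λ x → map (x ∷_) (allLists n m)) (allFin n)

allListVecs : (n : ℕ) → ∀ {s} → Vec ℕ s → List (Vec (List (Fin n)) s)
allListVecs n []       = [] ∷ []
allListVecs n (l ∷ ls) =
  concatMap (λ x → map (x ∷_) (allListVecs n ls)) (allLists n l)

_=ᶠ_ : ∀ {n} → Fin n → Fin n → Bool
x =ᶠ y = does (x FinP.≟ y)

_=ᵐ_ : ∀ {n} → Maybe (Fin n) → Maybe (Fin n) → Bool
x =ᵐ y = does (MaybeP.≡-dec FinP._≟_ x y)

_∈ᵇ_ : ∀ {n} → Fin n → List (Fin n) → Bool
x ∈ᵇ ys = anyᵇ (x =ᶠ_) ys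

distinct : ∀ {n} → List (Fin n) → Bool
distinct []       = true
distinct (x ∷ xs) = not (x ∈ᵇ xs) ∧ distinct xs

isPrefix : ∀ {n} → List (Fin n) → List (Fin n) → Bool
isPrefix []       _        = true
isPrefix (x ∷ xs) []       = false
isPrefix (x ∷ xs) (y ∷ ys) = (x =ᶠ y) ∧ isPrefix xs ys

windows : ∀ {A : Set} → ℕ → List A → List (List A)
windows w []       = []
windows w (x ∷ xs) =
  if w ℕ.≤ᵇ length (x ∷ xs) then take w (x ∷ xs) ∷ windows w xs else []

sumVec : ∀ {s} → Vec ℕ s → ℕ
sumVec = Vec.foldr _ ℕ._+_ 0

-- The function f.  fVec m L = (f(1,L), …, f(m+1,L)).
-- f(1,L) = L,  f(ℓ,L) = 1 + f(ℓ-1,L)^16 (ℓ-1)^2 max_{1≤i≤ℓ-1} f(i,L) f(ℓ-i,L).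

_^ℚ_ : ℚ → ℕ → ℚ
x ^ℚ zero  = 1ℚ
x ^ℚ suc m = x * (x ^ℚ m)

fVec : (m : ℕ) → ℚ → Vec ℚ (suc m)
fVec zero    L = L ∷ []
fVec (suc m) L = v ∷ʳ next
  where
  v : Vec ℚ (suc m)
  v = fVec m L
  -- ℓ = m + 2 ; index j ↦ f(j+1), and opposite j ↦ f(m+1-j) = f(ℓ-(j+1))
  next : ℚ
  next = 1ℚ + (Vec.last v ^ℚ 16) * (ι (suc m) ^ℚ 2)
             * foldr₁ _⊔_ (tabulate (λ j → lookup v j * lookup v (opposite j)))

-- f ℓ L for ℓ ≥ 1 (f 0 L is an unused junk value)
f : ℕ → ℚ → ℚ
f zero    L = 1ℚ
f (suc m) L = Vec.last (fVec m L)

record SimpleGraph (n : ℕ) : Set where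
  field
    Adj    : Fin n → Fin n → Bool
    sym    : ∀ x y → Adj x y ≡ Adj y x
    irrefl : ∀ x → Adj x x ≡ false
open SimpleGraph public

degree : ∀ {n} → SimpleGraph n → Fin n → ℕ
degree G v = count (Adj G v) (allFin _)

module Notions {n : ℕ} (G : SimpleGraph n) (L : ℚ) where

  V : Set
  V = Fin n

  walk : List V → Bool
  walk []           = true
  walk (x ∷ [])     = true
  walk (x ∷ y ∷ xs) = Adj G x y ∧ walk (y ∷ xs)

  isPath : ℕ → List V → Bool
  isPath ℓ p = (length p ℕ.≡ᵇ suc ℓ) ∧ walk p ∧ distinct p

  sameEnds : List V → List V → Bool
  sameEnds p q = (List.head p =ᵐ List.head q) ∧ (List.last p =ᵐ List.last q)

  mutual
    goodPath : ℕ → List V → Bool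
    goodPath zero          p = false
    goodPath (suc zero)    p = isPath 1 p
    goodPath (suc (suc m)) p =
      admPath (suc (suc m)) p ∧
      (ι (count (λ q → sameEnds p q ∧ admPath (suc (suc m)) q)
                (allLists n (suc (suc (suc m)))))
        ≤ᵇ f (suc (suc m)) L)

    admPath : ℕ → List V → Bool
    admPath zero          p = false
    admPath (suc zero)    p = isPath 1 p
    admPath (suc (suc m)) p = isPath (suc (suc m)) p ∧ subsGood (suc m) p

    subsGood : ℕ → List V → Bool
    subsGood zero    p = true
    subsGood (suc j) p =
      allᵇ (goodPath (suc j)) (windows (suc (suc j)) p) ∧ subsGood j p

  -- A (generalised) spider: a centre u and s legs; leg i is given by the
  -- list w_{i,1} … w_{i,ℓ_i} of its non-centre vertices, so the i-th leg
  -- as a path is u ∷ leg i.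
  Spider : ℕ → Set
  Spider s = V × Vec (List V) s

  centre : ∀ {s} → Spider s → V
  centre = proj₁

  legs : ∀ {s} → Spider s → Vec (List V) s
  legs = proj₂

  lengthVec : ∀ {s} → Spider s → Vec ℕ s
  lengthVec S = Vec.map length (legs S)

  totalLength : ∀ {s} → Spider s → ℕ
  totalLength S = sumVec (lengthVec S)

  endpoint : V → List V → V
  endpoint u []       = u
  endpoint u (x ∷ xs) = endpoint x xs

  leafVec : ∀ {s} → Spider s → Vec V s
  leafVec (u , ls) = Vec.map (endpoint u) ls

  sameLeaves : ∀ {s} → Spider s → Spider s → Bool
  sameLeaves S T = does (VecP.≡-dec FinP._≟_ (leafVec S) (leafVec T))

  validSpider : ∀ {s} → Spider s → Bool
  validSpider (u , ls) =
    allᵇ (λ P → walk (u ∷ P)) (Vec.toList ls) ∧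
    distinct (u ∷ List.concat (Vec.toList ls))

  allSpiders : ∀ {s} → Vec ℕ s → List (Spider s)
  allSpiders lv =
    filterᵇ validSpider
      (concatMap (λ u → map (u ,_) (allListVecs n lv)) (allFin n))

  allOnes : ∀ {s} → Vec ℕ s → Bool
  allOnes lv = allᵇ (ℕ._≡ᵇ 1) (Vec.toList lv)

  truncLeg : ∀ {s} → Spider s → Fin s → ℕ → Spider s
  truncLeg (u , ls) i j = u , Vec.updateAt ls i (take j)

  -- The recursion of the definition is on the total length; the first
  -- argument is fuel (any value ≥ the total length gives the same answer).
  mutual
    goodSpiderF : ∀ {s} → ℕ → Spider s → Bool
    goodSpiderF zero    S = false
    goodSpiderF (suc t) S =
      admSpiderF (suc t) S ∧
      (ι (count (λ T → sameLeaves S T ∧ admSpiderF (suc t) T)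
                (allSpiders (lengthVec S)))
        ≤ᵇ f (totalLength S) L)

    admSpiderF : ∀ {s} → ℕ → Spider s → Bool
    admSpiderF zero    S = false
    admSpiderF (suc t) S =
      validSpider S ∧
      (allOnes (lengthVec S) ∨
        (truncsGood t S ∧
         allᵇ (λ i → goodPath (lookup (lengthVec S) i)
                                  (centre S ∷ lookup (legs S) i))
                  (allFin _)))

    truncsGood : ∀ {s} → ℕ → Spider s → Bool
    truncsGood t S =
      allᵇ (λ i → allᵇ (λ j → goodSpiderF t (truncLeg S i j))
                               (List.drop 1 (upTo (lookup (lengthVec S) i))))
               (allFin _)

  admissibleSpider : ∀ {s} → Spider s → Bool
  admissibleSpider S = admSpiderF (totalLength S) S

  goodSpider : ∀ {s} → Spider s → Bool
  goodSpider S = goodSpiderF (totalLength S) S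

  subspiderOf : ∀ {s} → Spider s → Spider s → Bool
  subspiderOf (u , ls) (w , ms) =
    (u =ᶠ w) ∧ and (Vec.toList (Vec.zipWith isPrefix ls ms))

  -- subspider of S with length vector (ℓ_i - γ_i), γ_i ∈ {0,1} (true = 1)
  shrink : ∀ {s} → Spider s → Vec Bool s → Spider s
  shrink (u , ls) γ =
    u , Vec.zipWith (λ P g → if g then take (length P ∸ 1) P else P) ls γ

  bitSum : ∀ {s} → Vec Bool s → ℕ
  bitSum = Vec.foldr _ (λ g r → (if g then 1 else 0) ℕ.+ r) 0

module Submission where

-- Start from the family X of admissible but not good spiders with length vector ℓ⃗.
-- A bad spider's leaf vector carries more than f(ℓ,L) admissible spiders, and all of
-- them are bad, so every leaf class of X is large.  Prune X: while a surviving spider S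
-- violates (i) or (ii), delete either the survivors of its leaf class (fewer than half
-- of the class) or the fewer than δ^|γ|/L² survivors containing the subspider σ of S of
-- shape γ.  Each σ triggers at most one deletion and there are at most n Δ^(ℓ-|γ|) of
-- them (Δ the maximum degree), so deletions of the second kind remove at most
-- 2^s n Δ^ℓ / L² spiders; a class is deleted only after more than half of it went in
-- such deletions, which at most doubles the total.  Formally, neither kind of step
-- increases the potential L²·Cost + 2·Coverage, where a deleted spider costs 2 while its
-- class survives and 1 afterwards, and each still covered σ of shape γ weighs δ^|γ|.
-- Since Δ ≤ Kδ and |X| ≥ nδ^ℓ/L, deleting everything would force L ≤ 2^(s+1) K^(sk).

open import Defs
open import Data.Nat using (ℕ; _≤_)
open import Data.Rational using (ℚ) renaming (_≤_ to _≤ℚ_; _*_ to _*ℚ_)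
open import Data.Fin using (Fin)
open import Data.Bool using (Bool; true; false; _∧_; not)
open import Data.List using (List; []; _∷_; length; filterᵇ)
open import Data.List.Membership.Propositional using (_∈_)
open import Data.List.Relation.Unary.Unique.Propositional using (Unique)
open import Data.List.Relation.Unary.All using (All)
open import Data.Vec using (Vec)
import Data.Vec.Relation.Unary.All as VecAll
open import Data.Product using (Σ; ∃; ∃-syntax; _×_; _,_)
open import Relation.Binary.PropositionalEquality using (_≡_; _≢_)

open import Algebra.Bundles using (CommutativeMonoid)
import Algebra.Properties.CommutativeSemigroup as CommSemigroupProperties
open import Data.Bool using (if_then_else_; T)
open import Data.Bool.ListAction using (and) renaming (any to anyᵇ; all to allᵇ)
import Data.Bool.Properties as BoolP
open import Data.Empty using (⊥-elim)
import Data.Fin.Properties as FinP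
import Data.Integer as ℤ
import Data.Integer.Properties as ℤP
open import Data.List as List using (_++_; map; concatMap; cartesianProductWith; cartesianProduct; allFin)
open import Data.List.Extrema.Nat using (argmax; f[xs]≤f[argmax])
open import Data.List.Membership.Propositional using (find)
open import Data.List.Membership.Propositional.Properties
  using (∈-cartesianProductWith⁺; ∈-cartesianProductWith⁻; ∈-cartesianProduct⁺; ∈-cartesianProduct⁻; ∈-allFin;
         ∈-filter⁺; ∈-filter⁻)
import Data.List.Properties as LP
import Data.List.Relation.Unary.All as All
open import Data.List.Relation.Unary.All using ([])
open import Data.List.Relation.Unary.All.Properties using (¬All⇒Any¬)
open import Data.List.Relation.Unary.AllPairs using ([]; _∷_)
open import Data.List.Relation.Unary.Any using (here; there)
import Data.List.Relation.Unary.Unique.Propositional.Properties as UP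
open import Data.Nat as ℕ using (zero; suc; _+_; _*_; _^_; _∸_; _<_; z≤n; s≤s)
import Data.Nat.Coprimality as Coprimality
import Data.Nat.Properties as ℕP
open import Data.Product using (proj₁; proj₂)
open import Data.Rational as ℚ using (_≤ᵇ_; mkℚ; 0ℚ; 1ℚ; Positive; toℚᵘ) renaming (_+_ to _+ℚ_; _<_ to _<ℚ_)
import Data.Rational.Properties as ℚP
import Data.Rational.Unnormalised as ℚᵘ
import Data.Rational.Unnormalised.Properties as ℚᵘP
import Data.Vec as Vec
open import Data.Vec using ([]; _∷_)
import Data.Vec.Properties as VecP
open import Data.Vec.Relation.Unary.All using ([]; _∷_)
open import Function using (_∘_; id)
open import Function.Bundles using (Equivalence)
open import Relation.Binary.PropositionalEquality using (refl; trans; cong; cong₂; subst; module ≡-Reasoning)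
import Relation.Binary.PropositionalEquality as ≡
open import Relation.Nullary using (Dec; yes; no; ¬_)
open import Relation.Nullary.Decidable using (_×-dec_; does; dec-true; T?)

private
  variable
    A B C : Set

  module ℕ+ = CommSemigroupProperties ℕP.+-commutativeSemigroup
  module ℕ* = CommSemigroupProperties ℕP.*-commutativeSemigroup
  module ℚ* = CommSemigroupProperties (CommutativeMonoid.commutativeSemigroup ℚP.*-1-commutativeMonoid)

-- Rational arithmetic

ι≡mkℚ : ∀ n → ι n ≡ mkℚ (ℤ.+ n) 0 (Coprimality.sym (Coprimality.1-coprimeTo n))
ι≡mkℚ n = ℚP.normalize-coprime (Coprimality.sym (Coprimality.1-coprimeTo n))

toℚᵘ-ι : ∀ n → toℚᵘ (ι n) ≡ ℚᵘ.mkℚᵘ (ℤ.+ n) 0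
toℚᵘ-ι n rewrite ι≡mkℚ n = refl

ι-+ : ∀ m n → ι (m + n) ≡ ι m +ℚ ι n
ι-+ m n = ℚP.toℚᵘ-injective (begin
  toℚᵘ (ι (m + n))                          ≡⟨ toℚᵘ-ι (m + n) ⟩
  ℚᵘ.mkℚᵘ (ℤ.+ (m + n)) 0                   ≈⟨ ℚᵘ.*≡* cross ⟩
  ℚᵘ.mkℚᵘ (ℤ.+ m) 0 ℚᵘ.+ ℚᵘ.mkℚᵘ (ℤ.+ n) 0   ≡⟨ ≡.sym (cong₂ ℚᵘ._+_ (toℚᵘ-ι m) (toℚᵘ-ι n)) ⟩
  toℚᵘ (ι m) ℚᵘ.+ toℚᵘ (ι n)                ≈⟨ ℚᵘP.≃-sym (ℚP.toℚᵘ-homo-+ (ι m) (ι n)) ⟩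
  toℚᵘ (ι m +ℚ ι n)                         ∎)
  where
  open ℚᵘP.≃-Reasoning
  cross : ℤ.+ (m + n) ℤ.* ℤ.+ 1 ≡ (ℤ.+ m ℤ.* ℤ.+ 1 ℤ.+ ℤ.+ n ℤ.* ℤ.+ 1) ℤ.* ℤ.+ 1
  cross = cong (ℤ._* ℤ.+ 1) (trans (ℤP.pos-+ m n)
            (≡.sym (cong₂ ℤ._+_ (ℤP.*-identityʳ (ℤ.+ m)) (ℤP.*-identityʳ (ℤ.+ n)))))

ι-* : ∀ m n → ι (m * n) ≡ ι m *ℚ ι n
ι-* m n = ℚP.toℚᵘ-injective (begin
  toℚᵘ (ι (m * n))                          ≡⟨ toℚᵘ-ι (m * n) ⟩
  ℚᵘ.mkℚᵘ (ℤ.+ (m * n)) 0                   ≈⟨ ℚᵘ.*≡* (cong (ℤ._* ℤ.+ 1) (ℤP.pos-* m n)) ⟩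
  ℚᵘ.mkℚᵘ (ℤ.+ m) 0 ℚᵘ.* ℚᵘ.mkℚᵘ (ℤ.+ n) 0   ≡⟨ ≡.sym (cong₂ ℚᵘ._*_ (toℚᵘ-ι m) (toℚᵘ-ι n)) ⟩
  toℚᵘ (ι m) ℚᵘ.* toℚᵘ (ι n)                ≈⟨ ℚᵘP.≃-sym (ℚP.toℚᵘ-homo-* (ι m) (ι n)) ⟩
  toℚᵘ (ι m *ℚ ι n)                         ∎)
  where open ℚᵘP.≃-Reasoning

ι-^ : ∀ m k → ι (m ^ k) ≡ ι m ^ℚ k
ι-^ m zero    = refl
ι-^ m (suc k) = trans (ι-* m (m ^ k)) (cong (ι m *ℚ_) (ι-^ m k))

ι-mono-≤ : ∀ {m n} → m ≤ n → ι m ≤ℚ ι n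
ι-mono-≤ {m} {n} m≤n rewrite ι≡mkℚ m | ι≡mkℚ n =
  ℚ.*≤* (ℤP.*-monoʳ-≤-nonNeg (ℤ.+ 1) (ℤ.+≤+ m≤n))

ι-cancel-< : ∀ {m n} → ι m <ℚ ι n → m < n
ι-cancel-< {m} {n} ιm<ιn rewrite ι≡mkℚ m | ι≡mkℚ n with ιm<ιn
... | ℚ.*<* m<n rewrite ℤP.*-identityʳ (ℤ.+ m) | ℤP.*-identityʳ (ℤ.+ n) = ℤP.drop‿+<+ m<n

0≤ι : ∀ n → 0ℚ ≤ℚ ι n
0≤ι n = ι-mono-≤ {0} {n} z≤n

ι-pos : ∀ n → Positive (ι (suc n))
ι-pos n rewrite ι≡mkℚ (suc n) = _

0<ι : ∀ {n} → 0 < n → 0ℚ <ℚ ι n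
0<ι {suc n} _ = ℚP.positive⁻¹ (ι (suc n)) {{ι-pos n}}

*-monoˡ-≤-0≤ : ∀ {r p q} → 0ℚ ≤ℚ r → p ≤ℚ q → r *ℚ p ≤ℚ r *ℚ q
*-monoˡ-≤-0≤ {r} 0≤r = ℚP.*-monoˡ-≤-nonNeg r {{ℚ.nonNegative 0≤r}}

*-monoʳ-≤-0≤ : ∀ {r p q} → 0ℚ ≤ℚ r → p ≤ℚ q → p *ℚ r ≤ℚ q *ℚ r
*-monoʳ-≤-0≤ {r} 0≤r = ℚP.*-monoʳ-≤-nonNeg r {{ℚ.nonNegative 0≤r}}

0≤* : ∀ {p q} → 0ℚ ≤ℚ p → 0ℚ ≤ℚ q → 0ℚ ≤ℚ p *ℚ q
0≤* {p} {q} 0≤p 0≤q = ℚP.≤-trans (ℚP.≤-reflexive (≡.sym (ℚP.*-zeroˡ q))) (*-monoʳ-≤-0≤ 0≤q 0≤p)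

0≤^ℚ : ∀ {a} m → 0ℚ ≤ℚ a → 0ℚ ≤ℚ a ^ℚ m
0≤^ℚ zero    0≤a = 0≤ι 1
0≤^ℚ (suc m) 0≤a = 0≤* 0≤a (0≤^ℚ m 0≤a)

^ℚ-distribˡ-* : ∀ a b m → (a *ℚ b) ^ℚ m ≡ a ^ℚ m *ℚ b ^ℚ m
^ℚ-distribˡ-* a b zero    = refl
^ℚ-distribˡ-* a b (suc m) = trans (cong ((a *ℚ b) *ℚ_) (^ℚ-distribˡ-* a b m))
                                  (ℚ*.interchange a b (a ^ℚ m) (b ^ℚ m))

^ℚ-monoˡ-≤ : ∀ {a b} m → 0ℚ ≤ℚ a → a ≤ℚ b → a ^ℚ m ≤ℚ b ^ℚ m
^ℚ-monoˡ-≤ zero    0≤a a≤b = ℚP.≤-refl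
^ℚ-monoˡ-≤ {a} {b} (suc m) 0≤a a≤b = begin
  a *ℚ a ^ℚ m   ≤⟨ *-monoʳ-≤-0≤ (0≤^ℚ m 0≤a) a≤b ⟩
  b *ℚ a ^ℚ m   ≤⟨ *-monoˡ-≤-0≤ (ℚP.≤-trans 0≤a a≤b) (^ℚ-monoˡ-≤ m 0≤a a≤b) ⟩
  b *ℚ b ^ℚ m   ∎
  where open ℚP.≤-Reasoning

^ℚ-monoʳ-≤ : ∀ {a} → 1ℚ ≤ℚ a → ∀ {m m′} → m ≤ m′ → a ^ℚ m ≤ℚ a ^ℚ m′
^ℚ-monoʳ-≤ {a} 1≤a m≤m′ = go (ℕP.≤⇒≤′ m≤m′)
  where
  0≤a : 0ℚ ≤ℚ a
  0≤a = ℚP.≤-trans (0≤ι 1) 1≤a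
  go : ∀ {m m′} → m ℕ.≤′ m′ → a ^ℚ m ≤ℚ a ^ℚ m′
  go ℕ.≤′-refl                  = ℚP.≤-refl
  go {m} {suc m′} (ℕ.≤′-step p) = begin
    a ^ℚ m          ≤⟨ go p ⟩
    a ^ℚ m′         ≡⟨ ℚP.*-identityˡ (a ^ℚ m′) ⟨
    1ℚ *ℚ a ^ℚ m′   ≤⟨ *-monoʳ-≤-0≤ (0≤^ℚ m′ 0≤a) 1≤a ⟩
    a *ℚ a ^ℚ m′    ∎
    where open ℚP.≤-Reasoning

p<p+1 : ∀ p → p <ℚ p +ℚ 1ℚ
p<p+1 p = subst (_<ℚ p +ℚ 1ℚ) (ℚP.+-identityʳ p) (ℚP.+-mono-≤-< (ℚP.≤-refl {p}) (0<ι {1} (s≤s z≤n)))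

square-cancel-≤ : ∀ {L C y : ℚ} x → 0ℚ <ℚ L → 0 < x → 0ℚ ≤ℚ C →
  y ≤ℚ L *ℚ ι x → L *ℚ L *ℚ ι x ≤ℚ C *ℚ y → L ≤ℚ C
square-cancel-≤ {L} {C} {y} (suc x) 0<L _ 0≤C y≤Lx LLx≤Cy =
  ℚP.*-cancelʳ-≤-pos (L *ℚ ι (suc x)) {{Lx-pos}} (begin
    L *ℚ (L *ℚ ι (suc x))   ≡⟨ ℚP.*-assoc L L (ι (suc x)) ⟨
    L *ℚ L *ℚ ι (suc x)     ≤⟨ LLx≤Cy ⟩
    C *ℚ y                  ≤⟨ *-monoˡ-≤-0≤ 0≤C y≤Lx ⟩
    C *ℚ (L *ℚ ι (suc x))   ∎)
  where
  open ℚP.≤-Reasoning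
  Lx-pos : Positive (L *ℚ ι (suc x))
  Lx-pos = ℚP.pos*pos⇒pos L {{ℚ.positive 0<L}} (ι (suc x)) {{ι-pos x}}

0<-of-≤-*ι : ∀ {y L : ℚ} x → 0ℚ <ℚ y → y ≤ℚ L *ℚ ι x → 0 < x
0<-of-≤-*ι {y} {L} zero    0<y y≤L0 =
  ⊥-elim (ℚP.<-irrefl refl (ℚP.<-≤-trans 0<y (ℚP.≤-trans y≤L0 (ℚP.≤-reflexive (ℚP.*-zeroʳ L)))))
0<-of-≤-*ι (suc x) _ _ = s≤s z≤n

ι^ℚ-≤-scaled : ∀ {K D δ} ℓ {m} → ι D ≤ℚ K *ℚ ι δ → 1ℚ ≤ℚ K → ℓ ≤ m → ι D ^ℚ ℓ ≤ℚ K ^ℚ m *ℚ ι δ ^ℚ ℓ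
ι^ℚ-≤-scaled {K} {D} {δ} ℓ {m} D≤Kδ 1≤K ℓ≤m = begin
  ι D ^ℚ ℓ              ≤⟨ ^ℚ-monoˡ-≤ ℓ (0≤ι D) D≤Kδ ⟩
  (K *ℚ ι δ) ^ℚ ℓ       ≡⟨ ^ℚ-distribˡ-* K (ι δ) ℓ ⟩
  K ^ℚ ℓ *ℚ ι δ ^ℚ ℓ    ≤⟨ *-monoʳ-≤-0≤ (0≤^ℚ ℓ (0≤ι δ)) (^ℚ-monoʳ-≤ 1≤K ℓ≤m) ⟩
  K ^ℚ m *ℚ ι δ ^ℚ ℓ    ∎
  where open ℚP.≤-Reasoning

ι-*-^-≤-scaled : ∀ c n {K D δ} ℓ {m} → ι D ≤ℚ K *ℚ ι δ → 1ℚ ≤ℚ K → ℓ ≤ m →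
  ι (c * (n * D ^ ℓ)) ≤ℚ (ι c *ℚ K ^ℚ m) *ℚ (ι n *ℚ ι δ ^ℚ ℓ)
ι-*-^-≤-scaled c n {K} {D} {δ} ℓ {m} D≤Kδ 1≤K ℓ≤m = begin
  ι (c * (n * D ^ ℓ))
    ≡⟨ trans (ι-* c (n * D ^ ℓ)) (cong (ι c *ℚ_) (trans (ι-* n (D ^ ℓ)) (cong (ι n *ℚ_) (ι-^ D ℓ)))) ⟩
  ι c *ℚ (ι n *ℚ ι D ^ℚ ℓ)
    ≤⟨ *-monoˡ-≤-0≤ (0≤ι c) (*-monoˡ-≤-0≤ (0≤ι n) (ι^ℚ-≤-scaled {K} {D} {δ} ℓ D≤Kδ 1≤K ℓ≤m)) ⟩
  ι c *ℚ (ι n *ℚ (K ^ℚ m *ℚ ι δ ^ℚ ℓ))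
    ≡⟨ cong (ι c *ℚ_) (ℚ*.x∙yz≈y∙xz (ι n) (K ^ℚ m) (ι δ ^ℚ ℓ)) ⟩
  ι c *ℚ (K ^ℚ m *ℚ (ι n *ℚ ι δ ^ℚ ℓ))
    ≡⟨ ℚP.*-assoc (ι c) (K ^ℚ m) (ι n *ℚ ι δ ^ℚ ℓ) ⟨
  (ι c *ℚ K ^ℚ m) *ℚ (ι n *ℚ ι δ ^ℚ ℓ) ∎
  where open ℚP.≤-Reasoning

-- Counting in lists

does⇒ : ∀ {P : Set} (P? : Dec P) → does P? ≡ true → P
does⇒ (yes p) _ = p

_⇒ᵇ_ : (A → Bool) → (A → Bool) → Set
p ⇒ᵇ q = ∀ x → p x ≡ true → q x ≡ true

∑ : (A → ℕ) → List A → ℕ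
∑ f []       = 0
∑ f (x ∷ xs) = f x + ∑ f xs


count-++ : ∀ (p : A → Bool) xs ys → count p (xs ++ ys) ≡ count p xs + count p ys
count-++ p []       ys = refl
count-++ p (x ∷ xs) ys with p x
... | true  = cong suc (count-++ p xs ys)
... | false = count-++ p xs ys

count-map : ∀ (p : B → Bool) (f : A → B) xs → count p (map f xs) ≡ count (p ∘ f) xs
count-map p f []       = refl
count-map p f (x ∷ xs) with p (f x)
... | true  = cong suc (count-map p f xs)
... | false = count-map p f xs

count-filterᵇ : ∀ (p q : A → Bool) xs → count q (filterᵇ p xs) ≡ count (λ x → p x ∧ q x) xs
count-filterᵇ p q []       = refl
count-filterᵇ p q (x ∷ xs) with p x
... | false = count-filterᵇ p q xs
... | true with q x
...   | true  = cong suc (count-filterᵇ p q xs)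
...   | false = count-filterᵇ p q xs

count-cong : ∀ {p q : A → Bool} xs → (∀ {x} → x ∈ xs → p x ≡ q x) → count p xs ≡ count q xs
count-cong {p = p} {q = q} []       eq = refl
count-cong {p = p} {q = q} (x ∷ xs) eq with p x | q x | eq (here refl)
... | true  | true  | _ = cong suc (count-cong xs (eq ∘ there))
... | false | false | _ = count-cong xs (eq ∘ there)

count-mono : ∀ {p q : A → Bool} → p ⇒ᵇ q → ∀ xs → count p xs ≤ count q xs
count-mono {p = p} {q = q} p⇒q []       = z≤n
count-mono {p = p} {q = q} p⇒q (x ∷ xs) with p x in px | q x in qx
... | true  | true  = s≤s (count-mono p⇒q xs)
... | false | true  = ℕP.m≤n⇒m≤1+n (count-mono p⇒q xs)
... | false | false = count-mono p⇒q xs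
... | true  | false with () ← trans (≡.sym (p⇒q x px)) qx

count-mono-< : ∀ {p q : A → Bool} → p ⇒ᵇ q → ∀ {xs y} → y ∈ xs → p y ≡ false → q y ≡ true →
               count p xs < count q xs
count-mono-< {p = p} {q = q} p⇒q {x ∷ xs} (here refl) py qy rewrite py | qy = s≤s (count-mono p⇒q xs)
count-mono-< {p = p} {q = q} p⇒q {x ∷ xs} (there y∈xs) py qy with p x in px | q x in qx
... | true  | true  = s≤s (count-mono-< p⇒q y∈xs py qy)
... | false | true  = ℕP.m≤n⇒m≤1+n (count-mono-< p⇒q y∈xs py qy)
... | false | false = count-mono-< p⇒q y∈xs py qy
... | true  | false with () ← trans (≡.sym (p⇒q x px)) qx

count≤length : ∀ (p : A → Bool) xs → count p xs ≤ length xs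
count≤length p xs = LP.length-filter (T? ∘ p) xs

count-false : ∀ (xs : List A) → count (λ _ → false) xs ≡ 0
count-false []       = refl
count-false (_ ∷ xs) = count-false xs

count+count-not≡length : ∀ (p : A → Bool) xs → count p xs + count (not ∘ p) xs ≡ length xs
count+count-not≡length p []       = refl
count+count-not≡length p (x ∷ xs) with p x
... | true  = cong suc (count+count-not≡length p xs)
... | false = trans (ℕP.+-suc _ _) (cong suc (count+count-not≡length p xs))

∑-mono : ∀ {f g : A → ℕ} xs → (∀ {x} → x ∈ xs → f x ≤ g x) → ∑ f xs ≤ ∑ g xs
∑-mono []       f≤g = z≤n
∑-mono (x ∷ xs) f≤g = ℕP.+-mono-≤ (f≤g (here refl)) (∑-mono xs (f≤g ∘ there))

∑-mono-< : ∀ {f g : A → ℕ} {k} xs → (∀ {x} → x ∈ xs → f x ≤ g x) →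
           ∀ {y} → y ∈ xs → f y + k ≤ g y → ∑ f xs + k ≤ ∑ g xs
∑-mono-< {f = f} {g = g} {k = k} (x ∷ xs) f≤g (here refl) fx+k≤gx = begin
  f x + ∑ f xs + k   ≡⟨ ℕ+.xy∙z≈xz∙y (f x) (∑ f xs) k ⟩
  f x + k + ∑ f xs   ≤⟨ ℕP.+-mono-≤ fx+k≤gx (∑-mono xs (f≤g ∘ there)) ⟩
  g x + ∑ g xs       ∎
  where open ℕP.≤-Reasoning
∑-mono-< {f = f} {g = g} {k = k} (x ∷ xs) f≤g (there y∈xs) fy+k≤gy = begin
  f x + ∑ f xs + k   ≡⟨ ℕP.+-assoc (f x) (∑ f xs) k ⟩
  f x + (∑ f xs + k) ≤⟨ ℕP.+-mono-≤ (f≤g (here refl)) (∑-mono-< xs (f≤g ∘ there) y∈xs fy+k≤gy) ⟩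
  g x + ∑ g xs       ∎
  where open ℕP.≤-Reasoning

∑-+ : ∀ (f g : A → ℕ) xs → ∑ (λ x → f x + g x) xs ≡ ∑ f xs + ∑ g xs
∑-+ f g []       = refl
∑-+ f g (x ∷ xs) = trans (cong (f x + g x +_) (∑-+ f g xs)) (ℕ+.interchange (f x) (g x) (∑ f xs) (∑ g xs))

∑-*ˡ : ∀ c (f : A → ℕ) xs → ∑ (λ x → c * f x) xs ≡ c * ∑ f xs
∑-*ˡ c f []       = ≡.sym (ℕP.*-zeroʳ c)
∑-*ˡ c f (x ∷ xs) = trans (cong (c * f x +_) (∑-*ˡ c f xs)) (≡.sym (ℕP.*-distribˡ-+ c (f x) (∑ f xs)))

∑≤length* : ∀ {f : A → ℕ} {c} xs → (∀ {x} → x ∈ xs → f x ≤ c) → ∑ f xs ≤ length xs * c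
∑≤length* []       f≤c = z≤n
∑≤length* (x ∷ xs) f≤c = ℕP.+-mono-≤ (f≤c (here refl)) (∑≤length* xs (f≤c ∘ there))

∑≤count* : ∀ (p : A → Bool) {f : A → ℕ} {c} xs → (∀ {x} → x ∈ xs → f x ≤ (if p x then c else 0)) →
           ∑ f xs ≤ count p xs * c
∑≤count* p []       f≤ = z≤n
∑≤count* p (x ∷ xs) f≤ with p x | f≤ (here refl)
... | true  | fx≤c = ℕP.+-mono-≤ fx≤c (∑≤count* p xs (f≤ ∘ there))
... | false | fx≤0 = ℕP.+-mono-≤ fx≤0 (∑≤count* p xs (f≤ ∘ there))

count-cartesianProductWith : ∀ (p : C → Bool) (f : A → B → C) xs ys →
  count p (cartesianProductWith f xs ys) ≡ ∑ (λ x → count (p ∘ f x) ys) xs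
count-cartesianProductWith p f []       ys = refl
count-cartesianProductWith p f (x ∷ xs) ys = begin
  count p (map (f x) ys ++ cartesianProductWith f xs ys)            ≡⟨ count-++ p (map (f x) ys) _ ⟩
  count p (map (f x) ys) + count p (cartesianProductWith f xs ys)   ≡⟨ cong₂ _+_ (count-map p (f x) ys)
                                                                        (count-cartesianProductWith p f xs ys) ⟩
  count (p ∘ f x) ys + ∑ (λ x → count (p ∘ f x) ys) xs              ∎
  where open ≡-Reasoning

𝟙 : Bool → ℕ
𝟙 b = if b then 1 else 0

𝟙≤1 : ∀ b → 𝟙 b ≤ 1
𝟙≤1 true  = ℕP.≤-refl
𝟙≤1 false = z≤n

𝟙-mono : ∀ {a b} → (a ≡ true → b ≡ true) → 𝟙 a ≤ 𝟙 b
𝟙-mono {true}  a⇒b rewrite a⇒b refl = ℕP.≤-refl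
𝟙-mono {false} a⇒b = z≤n

∑-𝟙 : ∀ (p : A → Bool) xs → ∑ (𝟙 ∘ p) xs ≡ count p xs
∑-𝟙 p []       = refl
∑-𝟙 p (x ∷ xs) with p x
... | true  = cong suc (∑-𝟙 p xs)
... | false = ∑-𝟙 p xs

count-split : ∀ (p q : A → Bool) xs → count q xs ≡ count (λ x → p x ∧ q x) xs + count (λ x → not (p x) ∧ q x) xs
count-split p q []       = refl
count-split p q (x ∷ xs) with p x | q x
... | true  | true  = cong suc (count-split p q xs)
... | true  | false = count-split p q xs
... | false | true  = trans (cong suc (count-split p q xs)) (≡.sym (ℕP.+-suc _ _))
... | false | false = count-split p q xs

anyᵇ-intro : ∀ (p : A → Bool) {xs x} → x ∈ xs → p x ≡ true → anyᵇ p xs ≡ true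
anyᵇ-intro p {y ∷ xs} (here refl) px rewrite px = refl
anyᵇ-intro p {y ∷ xs} (there x∈xs) px with p y
... | true  = refl
... | false = anyᵇ-intro p x∈xs px

anyᵇ-mono : ∀ {p q : A → Bool} → p ⇒ᵇ q → ∀ xs → anyᵇ p xs ≡ true → anyᵇ q xs ≡ true
anyᵇ-mono {p = p} {q} p⇒q (x ∷ xs) any-p with p x in px
... | true  rewrite p⇒q x px = refl
... | false with q x
...   | true  = refl
...   | false = anyᵇ-mono p⇒q xs any-p

anyᵇ-false : ∀ (p : A → Bool) xs → (∀ x → p x ≡ false) → anyᵇ p xs ≡ false
anyᵇ-false p []       ¬p = refl
anyᵇ-false p (x ∷ xs) ¬p rewrite ¬p x = anyᵇ-false p xs ¬p

∧-true : ∀ {a b} → a ∧ b ≡ true → a ≡ true × b ≡ true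
∧-true {true} {true} refl = refl , refl

∧-not-∧ : ∀ a b → a ∧ not (a ∧ b) ≡ a ∧ not b
∧-not-∧ true  b = refl
∧-not-∧ false b = refl

∧-not-∧-comm : ∀ a b c → (c ≡ true → b ≡ false) → (a ∧ not b) ∧ c ≡ c ∧ a
∧-not-∧-comm a b false _    = BoolP.∧-zeroʳ (a ∧ not b)
∧-not-∧-comm a b true  c⇒¬b rewrite c⇒¬b refl = trans (BoolP.∧-identityʳ (a ∧ true)) (BoolP.∧-identityʳ a)

_∖_ : (A → Bool) → (A → Bool) → A → Bool
(p ∖ q) x = p x ∧ not (q x)

∖⇒ : ∀ (p q : A → Bool) → (p ∖ q) ⇒ᵇ p
∖⇒ p q x = proj₁ ∘ ∧-true

-- Enumerations

concatMap-map≡cartesianProductWith : ∀ (f : A → B → C) xs ys →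
  concatMap (λ x → map (f x) ys) xs ≡ cartesianProductWith f xs ys
concatMap-map≡cartesianProductWith f []       ys = refl
concatMap-map≡cartesianProductWith f (x ∷ xs) ys =
  cong (map (f x) ys ++_) (concatMap-map≡cartesianProductWith f xs ys)

module _ {n : ℕ} where

  allLists-suc : ∀ m → allLists n (suc m) ≡ cartesianProductWith _∷_ (allFin n) (allLists n m)
  allLists-suc m = concatMap-map≡cartesianProductWith _∷_ (allFin n) (allLists n m)

  allListVecs-∷ : ∀ {s} l (lv : Vec ℕ s) →
    allListVecs n (l ∷ lv) ≡ cartesianProductWith _∷_ (allLists n l) (allListVecs n lv)
  allListVecs-∷ l lv = concatMap-map≡cartesianProductWith _∷_ (allLists n l) (allListVecs n lv)

  ∈-allLists⁺ : ∀ (P : List (Fin n)) → P ∈ allLists n (length P)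
  ∈-allLists⁺ []      = here refl
  ∈-allLists⁺ (x ∷ P) rewrite allLists-suc (length P) =
    ∈-cartesianProductWith⁺ _∷_ (∈-allFin x) (∈-allLists⁺ P)

  ∈-allLists⁻ : ∀ m {P} → P ∈ allLists n m → length P ≡ m
  ∈-allLists⁻ zero    (here refl) = refl
  ∈-allLists⁻ (suc m) P∈ rewrite allLists-suc m
    with _ , P′ , _ , P′∈ , refl ← ∈-cartesianProductWith⁻ _∷_ (allFin n) (allLists n m) P∈ =
    cong suc (∈-allLists⁻ m P′∈)

  allLists-unique : ∀ m → Unique (allLists n m)
  allLists-unique zero    = [] ∷ []
  allLists-unique (suc m) rewrite allLists-suc m =
    UP.cartesianProductWith⁺ _∷_ LP.∷-injective (UP.allFin⁺ n) (allLists-unique m)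

  ∈-allListVecs⁺ : ∀ {s} (Ps : Vec (List (Fin n)) s) → Ps ∈ allListVecs n (Vec.map length Ps)
  ∈-allListVecs⁺ []       = here refl
  ∈-allListVecs⁺ (P ∷ Ps) rewrite allListVecs-∷ (length P) (Vec.map length Ps) =
    ∈-cartesianProductWith⁺ _∷_ (∈-allLists⁺ P) (∈-allListVecs⁺ Ps)

  ∈-allListVecs⁻ : ∀ {s} (lv : Vec ℕ s) {Ps} → Ps ∈ allListVecs n lv → Vec.map length Ps ≡ lv
  ∈-allListVecs⁻ []       (here refl) = refl
  ∈-allListVecs⁻ (l ∷ lv) Ps∈ rewrite allListVecs-∷ l lv
    with _ , _ , P∈ , Ps′∈ , refl ← ∈-cartesianProductWith⁻ _∷_ (allLists n l) (allListVecs n lv) Ps∈ =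
    cong₂ _∷_ (∈-allLists⁻ l P∈) (∈-allListVecs⁻ lv Ps′∈)

  allListVecs-unique : ∀ {s} (lv : Vec ℕ s) → Unique (allListVecs n lv)
  allListVecs-unique []       = [] ∷ []
  allListVecs-unique (l ∷ lv) rewrite allListVecs-∷ l lv =
    UP.cartesianProductWith⁺ _∷_ VecP.∷-injective (allLists-unique l) (allListVecs-unique lv)

allBits : ∀ s → List (Vec Bool s)
allBits zero    = [] ∷ []
allBits (suc s) = cartesianProductWith _∷_ (true ∷ false ∷ []) (allBits s)

∈-allBits : ∀ {s} (γ : Vec Bool s) → γ ∈ allBits s
∈-allBits []      = here refl
∈-allBits (g ∷ γ) = ∈-cartesianProductWith⁺ _∷_ (bit∈ g) (∈-allBits γ)
  where
  bit∈ : ∀ g → g ∈ true ∷ false ∷ []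
  bit∈ true  = here refl
  bit∈ false = there (here refl)

length-allBits : ∀ s → length (allBits s) ≡ 2 ^ s
length-allBits zero    = refl
length-allBits (suc s) = begin
  length (cartesianProductWith _∷_ (true ∷ false ∷ []) (allBits s))  ≡⟨ LP.length-++ (map (true ∷_) (allBits s)) ⟩
  length (map (true ∷_) (allBits s)) + length (map (false ∷_) (allBits s) ++ [])
    ≡⟨ cong₂ _+_ (LP.length-map (true ∷_) (allBits s))
                 (trans (cong length (LP.++-identityʳ (map (false ∷_) (allBits s))))
                        (LP.length-map (false ∷_) (allBits s))) ⟩
  length (allBits s) + length (allBits s)                             ≡⟨ cong (λ m → m + m) (length-allBits s) ⟩
  2 ^ s + 2 ^ s                                                       ≡⟨ cong (2 ^ s +_) (ℕP.+-identityʳ (2 ^ s)) ⟨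
  2 ^ s + (2 ^ s + 0)                                                 ∎
  where open ≡-Reasoning

-- Pruning

costOf : Bool → Bool → ℕ
costOf true  classAlive = 0
costOf false classAlive = suc (𝟙 classAlive)

costOf-mono : ∀ kept {alive alive′} → (alive′ ≡ true → alive ≡ true) → costOf kept alive′ ≤ costOf kept alive
costOf-mono true  _   = z≤n
costOf-mono false a⇒a = s≤s (𝟙-mono a⇒a)

costOf-removeClass : ∀ kept inClass {alive alive′} →
  (inClass ≡ true → alive ≡ true) → (inClass ≡ true → alive′ ≡ false) → (alive′ ≡ true → alive ≡ true) →
  costOf (kept ∧ not inClass) alive′ + 𝟙 (not kept ∧ inClass) ≤ costOf kept alive + 𝟙 (kept ∧ inClass)
costOf-removeClass true  true  _     dead _ rewrite dead refl = ℕP.≤-refl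
costOf-removeClass false true  alive dead _ rewrite alive refl | dead refl = ℕP.≤-refl
costOf-removeClass true  false _     _    _ = z≤n
costOf-removeClass false false _     _    a⇒a = ℕP.+-monoˡ-≤ 0 (costOf-mono false a⇒a)

costOf-removeCover : ∀ kept covers {alive alive′} → (alive′ ≡ true → alive ≡ true) →
  costOf (kept ∧ not covers) alive′ ≤ costOf kept alive + 2 * 𝟙 (kept ∧ covers)
costOf-removeCover true  true  {alive′ = alive′} _ = s≤s (𝟙≤1 alive′)
costOf-removeCover true  false _ = z≤n
costOf-removeCover false covers {alive} a⇒a = ℕP.≤-trans (costOf-mono false a⇒a) (ℕP.m≤m+n (suc (𝟙 alive)) 0)

module Pruning
  {Elem Piece Shape : Set}
  (X : List Elem)
  (_∼_ : Elem → Elem → Bool)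
  (∼-refl : ∀ S → S ∼ S ≡ true)
  (∼-sym : ∀ {S T} → S ∼ T ≡ true → T ∼ S ≡ true)
  (∼-trans : ∀ {S T U} → S ∼ T ≡ true → T ∼ U ≡ true → S ∼ U ≡ true)
  (F : ℚ)
  (heavy : ∀ {S} → S ∈ X → F <ℚ ι (count (S ∼_) X))
  (shapes : List Shape)
  (shrink : Elem → Shape → Piece)
  (_⊑_ : Piece → Elem → Bool)
  (shrink-⊑ : ∀ S γ → shrink S γ ⊑ S ≡ true)
  (w : Shape → ℕ)
  (Λ : ℚ)
  (0≤Λ : 0ℚ ≤ℚ Λ)
  (pieces : Shape → List Piece)
  (shrink∈pieces : ∀ {S} → S ∈ X → ∀ {γ} → γ ∈ shapes → shrink S γ ∈ pieces γ)
  where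

  kept : (Elem → Bool) → List Elem
  kept p = filterᵇ p X

  ClassLarge : (Elem → Bool) → Elem → Set
  ClassLarge p S = F ≤ℚ ι 2 *ℚ ι (count (S ∼_) (kept p))

  PieceCovered : (Elem → Bool) → Elem → Shape → Set
  PieceCovered p S γ = ι (w γ) ≤ℚ Λ *ℚ ι (count (shrink S γ ⊑_) (kept p))

  Balanced : (Elem → Bool) → Elem → Set
  Balanced p S = ClassLarge p S × All (PieceCovered p S) shapes

  pieceCovered? : ∀ p S γ → Dec (PieceCovered p S γ)
  pieceCovered? p S γ = ι (w γ) ℚP.≤? Λ *ℚ ι (count (shrink S γ ⊑_) (kept p))

  classLarge? : ∀ p S → Dec (ClassLarge p S)
  classLarge? p S = F ℚP.≤? ι 2 *ℚ ι (count (S ∼_) (kept p))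

  balanced? : ∀ p S → Dec (Balanced p S)
  balanced? p S = classLarge? p S ×-dec All.all? (pieceCovered? p S) shapes

  someKept : (Elem → Bool) → (Elem → Bool) → Bool
  someKept p q = anyᵇ (λ T → p T ∧ q T) X

  someKept-intro : ∀ {p q T} → T ∈ X → p T ≡ true → q T ≡ true → someKept p q ≡ true
  someKept-intro {p} {q} T∈X pT qT = anyᵇ-intro (λ T → p T ∧ q T) T∈X (cong₂ _∧_ pT qT)

  someKept-mono : ∀ {p′ p} → p′ ⇒ᵇ p → ∀ q → someKept p′ q ≡ true → someKept p q ≡ true
  someKept-mono {p′} {p} p′⇒p q = anyᵇ-mono kept⇒kept X
    where
    kept⇒kept : (λ T → p′ T ∧ q T) ⇒ᵇ (λ T → p T ∧ q T)
    kept⇒kept T pq with ∧-true {p′ T} pq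
    ... | p′T , qT = cong₂ _∧_ (p′⇒p T p′T) qT

  someKept-∖ : ∀ p {q r} → (∀ T → r T ≡ true → q T ≡ true) → someKept (p ∖ q) r ≡ false
  someKept-∖ p {q} {r} r⇒q = anyᵇ-false _ X lost
    where
    lost : ∀ T → (p ∖ q) T ∧ r T ≡ false
    lost T with r T in rT
    ... | false = BoolP.∧-zeroʳ _
    ... | true rewrite r⇒q T rT = cong (_∧ true) (BoolP.∧-zeroʳ (p T))

  count-∖-< : ∀ {p q S} → S ∈ X → p S ≡ true → q S ≡ true → count (p ∖ q) X < count p X
  count-∖-< {p} {q} S∈X pS qS =
    count-mono-< (∖⇒ p q) S∈X (cong₂ (λ a b → a ∧ not b) pS qS) pS

  cost : (Elem → Bool) → Elem → ℕ
  cost p T = costOf (p T) (someKept p (T ∼_))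

  Cost : (Elem → Bool) → ℕ
  Cost p = ∑ (cost p) X

  Coverage : (Elem → Bool) → ℕ
  Coverage p = ∑ (λ γ → w γ * count (λ σ → someKept p (σ ⊑_)) (pieces γ)) shapes

  maxCoverage : ℕ
  maxCoverage = ∑ (λ γ → w γ * length (pieces γ)) shapes

  potential : (Elem → Bool) → ℚ
  potential p = Λ *ℚ ι (Cost p) +ℚ ι (2 * Coverage p)

  removed≤Cost : ∀ p → count (not ∘ p) X ≤ Cost p
  removed≤Cost p = begin
    count (not ∘ p) X      ≡⟨ ∑-𝟙 (not ∘ p) X ⟨
    ∑ (𝟙 ∘ not ∘ p) X      ≤⟨ ∑-mono X (λ {T} _ → 𝟙-not≤costOf (p T)) ⟩
    Cost p                 ∎
    where
    open ℕP.≤-Reasoning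
    𝟙-not≤costOf : ∀ kept {alive} → 𝟙 (not kept) ≤ costOf kept alive
    𝟙-not≤costOf true  = z≤n
    𝟙-not≤costOf false = s≤s z≤n

  Cost-removeClass : ∀ {p S} → S ∈ X → p S ≡ true →
    count (λ T → p T ∧ S ∼ T) X ≤ count (λ T → not (p T) ∧ S ∼ T) X → Cost (p ∖ (S ∼_)) ≤ Cost p
  Cost-removeClass {p} {S} S∈X pS x≤y = ℕP.+-cancelʳ-≤ y _ _ (begin
    Cost p′ + y                                     ≡⟨ cong (Cost p′ +_) (∑-𝟙 (λ T → not (p T) ∧ S ∼ T) X) ⟨
    Cost p′ + ∑ (λ T → 𝟙 (not (p T) ∧ S ∼ T)) X      ≡⟨ ∑-+ (cost p′) _ X ⟨
    ∑ (λ T → cost p′ T + 𝟙 (not (p T) ∧ S ∼ T)) X    ≤⟨ ∑-mono X (λ {T} _ → pointwise T) ⟩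
    ∑ (λ T → cost p T + 𝟙 (p T ∧ S ∼ T)) X           ≡⟨ ∑-+ (cost p) _ X ⟩
    Cost p + ∑ (λ T → 𝟙 (p T ∧ S ∼ T)) X             ≡⟨ cong (Cost p +_) (∑-𝟙 (λ T → p T ∧ S ∼ T) X) ⟩
    Cost p + count (λ T → p T ∧ S ∼ T) X             ≤⟨ ℕP.+-monoʳ-≤ (Cost p) x≤y ⟩
    Cost p + y                                      ∎)
    where
    open ℕP.≤-Reasoning
    p′ = p ∖ (S ∼_)
    y = count (λ T → not (p T) ∧ S ∼ T) X
    pointwise : ∀ T → cost p′ T + 𝟙 (not (p T) ∧ S ∼ T) ≤ cost p T + 𝟙 (p T ∧ S ∼ T)
    pointwise T = costOf-removeClass (p T) (S ∼ T)
      (λ S∼T → someKept-intro {p} {T ∼_} S∈X pS (∼-sym S∼T))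
      (λ S∼T → someKept-∖ p (λ U T∼U → ∼-trans S∼T T∼U))
      (someKept-mono (∖⇒ p (S ∼_)) (T ∼_))

  Cost-removeCover : ∀ p q → Cost (p ∖ q) ≤ Cost p + 2 * count (λ T → p T ∧ q T) X
  Cost-removeCover p q = begin
    Cost (p ∖ q)                                    ≤⟨ ∑-mono X (λ {T} _ → pointwise T) ⟩
    ∑ (λ T → cost p T + 2 * 𝟙 (p T ∧ q T)) X         ≡⟨ ∑-+ (cost p) _ X ⟩
    Cost p + ∑ (λ T → 2 * 𝟙 (p T ∧ q T)) X           ≡⟨ cong (Cost p +_) (∑-*ˡ 2 _ X) ⟩
    Cost p + 2 * ∑ (λ T → 𝟙 (p T ∧ q T)) X           ≡⟨ cong (λ c → Cost p + 2 * c) (∑-𝟙 (λ T → p T ∧ q T) X) ⟩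
    Cost p + 2 * count (λ T → p T ∧ q T) X           ∎
    where
    open ℕP.≤-Reasoning
    pointwise : ∀ T → cost (p ∖ q) T ≤ cost p T + 2 * 𝟙 (p T ∧ q T)
    pointwise T = costOf-removeCover (p T) (q T) (someKept-mono (∖⇒ p q) (T ∼_))

  Coverage-mono : ∀ {p′ p} → p′ ⇒ᵇ p → Coverage p′ ≤ Coverage p
  Coverage-mono p′⇒p = ∑-mono shapes λ {γ} _ →
    ℕP.*-monoʳ-≤ (w γ) (count-mono (λ σ → someKept-mono p′⇒p (σ ⊑_)) (pieces γ))

  Coverage≤maxCoverage : ∀ p → Coverage p ≤ maxCoverage
  Coverage≤maxCoverage p =
    ∑-mono shapes λ {γ} _ → ℕP.*-monoʳ-≤ (w γ) (count≤length (λ σ → someKept p (σ ⊑_)) (pieces γ))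

  Coverage-removeCover : ∀ {p S γ} → S ∈ X → p S ≡ true → γ ∈ shapes →
    Coverage (p ∖ (shrink S γ ⊑_)) + w γ ≤ Coverage p
  Coverage-removeCover {p} {S} {γ} S∈X pS γ∈shapes =
    ∑-mono-< shapes (λ {γ′} _ → ℕP.*-monoʳ-≤ (w γ′) (count-mono covered-mono (pieces γ′))) γ∈shapes
      (begin
        w γ * c′ + w γ   ≡⟨ ℕP.+-comm (w γ * c′) (w γ) ⟩
        w γ + w γ * c′   ≡⟨ ℕP.*-suc (w γ) c′ ⟨
        w γ * suc c′     ≤⟨ ℕP.*-monoʳ-≤ (w γ) c′<c ⟩
        w γ * c          ∎)
    where
    open ℕP.≤-Reasoning
    σ = shrink S γ
    p′ = p ∖ (σ ⊑_)
    covered-mono : (λ τ → someKept p′ (τ ⊑_)) ⇒ᵇ (λ τ → someKept p (τ ⊑_))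
    covered-mono τ = someKept-mono (∖⇒ p (σ ⊑_)) (τ ⊑_)
    c′ = count (λ τ → someKept p′ (τ ⊑_)) (pieces γ)
    c = count (λ τ → someKept p (τ ⊑_)) (pieces γ)
    c′<c : c′ < c
    c′<c = count-mono-< covered-mono (shrink∈pieces S∈X γ∈shapes)
             (someKept-∖ p (λ _ → id)) (someKept-intro {p} {σ ⊑_} S∈X pS (shrink-⊑ S γ))

  potential-mono : ∀ {p′ p} → p′ ⇒ᵇ p → Cost p′ ≤ Cost p → potential p′ ≤ℚ potential p
  potential-mono p′⇒p Cost≤ =
    ℚP.+-mono-≤ (*-monoˡ-≤-0≤ 0≤Λ (ι-mono-≤ Cost≤)) (ι-mono-≤ (ℕP.*-monoʳ-≤ 2 (Coverage-mono p′⇒p)))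

  potential-exchange : ∀ {p′ p r w₀} → Cost p′ ≤ Cost p + 2 * r → Coverage p′ + w₀ ≤ Coverage p →
    Λ *ℚ ι r <ℚ ι w₀ → potential p′ ≤ℚ potential p
  potential-exchange {p′} {p} {r} {w₀} Cost≤ Coverage< Λr<w₀ = begin
    Λ *ℚ ι (Cost p′) +ℚ ι (2 * Coverage p′)
      ≤⟨ ℚP.+-monoˡ-≤ (ι (2 * Coverage p′)) (*-monoˡ-≤-0≤ 0≤Λ (ι-mono-≤ Cost≤)) ⟩
    Λ *ℚ ι (Cost p + 2 * r) +ℚ ι (2 * Coverage p′)
      ≡⟨ cong (λ z → Λ *ℚ z +ℚ ι (2 * Coverage p′)) (ι-+ (Cost p) (2 * r)) ⟩
    Λ *ℚ (ι (Cost p) +ℚ ι (2 * r)) +ℚ ι (2 * Coverage p′)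
      ≡⟨ cong (_+ℚ ι (2 * Coverage p′)) (ℚP.*-distribˡ-+ Λ (ι (Cost p)) (ι (2 * r))) ⟩
    Λ *ℚ ι (Cost p) +ℚ Λ *ℚ ι (2 * r) +ℚ ι (2 * Coverage p′)
      ≡⟨ ℚP.+-assoc (Λ *ℚ ι (Cost p)) (Λ *ℚ ι (2 * r)) (ι (2 * Coverage p′)) ⟩
    Λ *ℚ ι (Cost p) +ℚ (Λ *ℚ ι (2 * r) +ℚ ι (2 * Coverage p′))
      ≤⟨ ℚP.+-monoʳ-≤ (Λ *ℚ ι (Cost p)) (ℚP.+-monoˡ-≤ (ι (2 * Coverage p′)) Λ2r≤2w₀) ⟩
    Λ *ℚ ι (Cost p) +ℚ (ι (2 * w₀) +ℚ ι (2 * Coverage p′))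
      ≡⟨ cong (Λ *ℚ ι (Cost p) +ℚ_) (ι-+ (2 * w₀) (2 * Coverage p′)) ⟨
    Λ *ℚ ι (Cost p) +ℚ ι (2 * w₀ + 2 * Coverage p′)
      ≤⟨ ℚP.+-monoʳ-≤ (Λ *ℚ ι (Cost p)) (ι-mono-≤ coverage-freed) ⟩
    Λ *ℚ ι (Cost p) +ℚ ι (2 * Coverage p) ∎
    where
    open ℚP.≤-Reasoning
    coverage-freed : 2 * w₀ + 2 * Coverage p′ ≤ 2 * Coverage p
    coverage-freed = subst (_≤ 2 * Coverage p)
      (trans (cong (2 *_) (ℕP.+-comm (Coverage p′) w₀)) (ℕP.*-distribˡ-+ 2 w₀ (Coverage p′)))
      (ℕP.*-monoʳ-≤ 2 Coverage<)
    Λ2r≤2w₀ : Λ *ℚ ι (2 * r) ≤ℚ ι (2 * w₀)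
    Λ2r≤2w₀ = begin
      Λ *ℚ ι (2 * r)      ≡⟨ cong (Λ *ℚ_) (ι-* 2 r) ⟩
      Λ *ℚ (ι 2 *ℚ ι r)   ≡⟨ ℚ*.x∙yz≈y∙xz Λ (ι 2) (ι r) ⟩
      ι 2 *ℚ (Λ *ℚ ι r)   ≤⟨ *-monoˡ-≤-0≤ (0≤ι 2) (ℚP.<⇒≤ Λr<w₀) ⟩
      ι 2 *ℚ ι w₀         ≡⟨ ι-* 2 w₀ ⟨
      ι (2 * w₀)          ∎

  Improvement : (Elem → Bool) → Set
  Improvement p = Σ (Elem → Bool) λ p′ → count p′ X < count p X × potential p′ ≤ℚ potential p

  removeClass : ∀ {p S} → S ∈ X → p S ≡ true → ¬ ClassLarge p S → Improvement p
  removeClass {p} {S} S∈X pS unbalanced =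
    p ∖ (S ∼_) , count-∖-< S∈X pS (∼-refl S) , potential-mono (∖⇒ p (S ∼_)) (Cost-removeClass S∈X pS x≤y)
    where
    x = count (λ T → p T ∧ S ∼ T) X
    y = count (λ T → not (p T) ∧ S ∼ T) X
    2x<x+y : 2 * x < x + y
    2x<x+y = ι-cancel-< (begin-strict
      ι (2 * x)                           ≡⟨ ι-* 2 x ⟩
      ι 2 *ℚ ι x                          ≡⟨ cong (λ c → ι 2 *ℚ ι c) (count-filterᵇ p (S ∼_) X) ⟨
      ι 2 *ℚ ι (count (S ∼_) (kept p))   <⟨ ℚP.≰⇒> unbalanced ⟩
      F                                   <⟨ heavy S∈X ⟩
      ι (count (S ∼_) X)                  ≡⟨ cong ι (count-split p (S ∼_) X) ⟩
      ι (x + y)                           ∎)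
      where open ℚP.≤-Reasoning
    x≤y : x ≤ y
    x≤y = ℕP.<⇒≤ (ℕP.+-cancelˡ-< x x y (subst (_< x + y) (cong (x +_) (ℕP.+-identityʳ x)) 2x<x+y))

  removeCover : ∀ {p S γ} → S ∈ X → p S ≡ true → γ ∈ shapes →
    ¬ PieceCovered p S γ → Improvement p
  removeCover {p} {S} {γ} S∈X pS γ∈shapes unbalanced =
    p ∖ (σ ⊑_) , count-∖-< S∈X pS (shrink-⊑ S γ) ,
    potential-exchange {r = count (λ T → p T ∧ σ ⊑ T) X} (Cost-removeCover p (σ ⊑_))
      (Coverage-removeCover S∈X pS γ∈shapes) Λr<w
    where
    σ = shrink S γ
    Λr<w : Λ *ℚ ι (count (λ T → p T ∧ σ ⊑ T) X) <ℚ ι (w γ)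
    Λr<w = subst (λ c → Λ *ℚ ι c <ℚ ι (w γ)) (count-filterᵇ p (σ ⊑_) X) (ℚP.≰⇒> unbalanced)

  improve : ∀ {p S} → S ∈ kept p → ¬ Balanced p S → Improvement p
  improve {p} {S} S∈kept unbalanced = byViolation (classLarge? p S)
    where
    S∈X = proj₁ (∈-filter⁻ (T? ∘ p) {xs = X} S∈kept)
    pS = Equivalence.to BoolP.T-≡ (proj₂ (∈-filter⁻ (T? ∘ p) {xs = X} S∈kept))
    byViolation : Dec (ClassLarge p S) → Improvement p
    byViolation (no small)  = removeClass S∈X pS small
    byViolation (yes large) =
      let γ , γ∈shapes , uncovered = find (¬All⇒Any¬ (pieceCovered? p S) shapes (unbalanced ∘ (large ,_)))
      in removeCover S∈X pS γ∈shapes uncovered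

  Pruned : Set
  Pruned = Σ (Elem → Bool) λ p → All (Balanced p) (kept p) × Λ *ℚ ι (count (not ∘ p) X) ≤ℚ ι (2 * maxCoverage)

  prune-from : ∀ fuel p → count p X < fuel → potential p ≤ℚ ι (2 * maxCoverage) → Pruned
  prune-from (suc fuel) p p<fuel bounded = byBalance (All.all? (balanced? p) (kept p))
    where
    open ℚP.≤-Reasoning
    byBalance : Dec (All (Balanced p) (kept p)) → Pruned
    byBalance (yes allBalanced) = p , allBalanced , (begin
      Λ *ℚ ι (count (not ∘ p) X)      ≤⟨ *-monoˡ-≤-0≤ 0≤Λ (ι-mono-≤ (removed≤Cost p)) ⟩
      Λ *ℚ ι (Cost p)                 ≡⟨ ℚP.+-identityʳ (Λ *ℚ ι (Cost p)) ⟨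
      Λ *ℚ ι (Cost p) +ℚ 0ℚ           ≤⟨ ℚP.+-monoʳ-≤ (Λ *ℚ ι (Cost p)) (0≤ι (2 * Coverage p)) ⟩
      potential p                     ≤⟨ bounded ⟩
      ι (2 * maxCoverage)             ∎)
    byBalance (no notAllBalanced) =
      let S , S∈kept , unbalanced = find (¬All⇒Any¬ (balanced? p) (kept p) notAllBalanced)
          p′ , fewer , potential≤ = improve S∈kept unbalanced
      in prune-from fuel p′ (ℕP.<-≤-trans fewer (ℕP.≤-pred p<fuel)) (ℚP.≤-trans potential≤ bounded)

  prune : Pruned
  prune = prune-from (suc (length X)) all (s≤s (count≤length all X)) (begin
    Λ *ℚ ι (Cost all) +ℚ ι (2 * Coverage all)   ≡⟨ cong (λ c → Λ *ℚ ι c +ℚ ι (2 * Coverage all)) (nothing-removed X) ⟩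
    Λ *ℚ 0ℚ +ℚ ι (2 * Coverage all)             ≡⟨ cong (_+ℚ ι (2 * Coverage all)) (ℚP.*-zeroʳ Λ) ⟩
    0ℚ +ℚ ι (2 * Coverage all)                  ≡⟨ ℚP.+-identityˡ (ι (2 * Coverage all)) ⟩
    ι (2 * Coverage all)                        ≤⟨ ι-mono-≤ (ℕP.*-monoʳ-≤ 2 (Coverage≤maxCoverage all)) ⟩
    ι (2 * maxCoverage)                         ∎)
    where
    open ℚP.≤-Reasoning
    all : Elem → Bool
    all _ = true
    nothing-removed : ∀ xs → ∑ (cost all) xs ≡ 0
    nothing-removed []       = refl
    nothing-removed (_ ∷ xs) = nothing-removed xs

-- Spiders

_⊖_ : ∀ {s} → Vec ℕ s → Vec Bool s → Vec ℕ s
lv ⊖ γ = Vec.zipWith (λ l g → l ∸ 𝟙 g) lv γ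

threshold : ℕ → ℕ → ℚ → ℚ
threshold s m K = ι (2 * 2 ^ s) *ℚ K ^ℚ m

0≤threshold : ∀ s m {K} → 1ℚ ≤ℚ K → 0ℚ ≤ℚ threshold s m K
0≤threshold s m 1≤K = 0≤* (0≤ι (2 * 2 ^ s)) (0≤^ℚ m (ℚP.≤-trans (0≤ι 1) 1≤K))

module SpiderFacts {n : ℕ} (G : SimpleGraph n) (L : ℚ) where
  open Notions G L

  bitSum+sumVec-⊖ : ∀ {s} (lv : Vec ℕ s) (γ : Vec Bool s) → VecAll.All (1 ≤_) lv →
    bitSum γ + sumVec (lv ⊖ γ) ≡ sumVec lv
  bitSum+sumVec-⊖ []           []          []         = refl
  bitSum+sumVec-⊖ (suc l ∷ lv) (true ∷ γ)  (_ ∷ 1≤lv) =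
    cong suc (trans (ℕ+.x∙yz≈y∙xz (bitSum γ) l _) (cong (l +_) (bitSum+sumVec-⊖ lv γ 1≤lv)))
  bitSum+sumVec-⊖ (l ∷ lv)     (false ∷ γ) (_ ∷ 1≤lv) =
    trans (ℕ+.x∙yz≈y∙xz (bitSum γ) l _) (cong (l +_) (bitSum+sumVec-⊖ lv γ 1≤lv))

  sameLeaves⇒≡ : ∀ {s} {S T : Spider s} → sameLeaves S T ≡ true → leafVec S ≡ leafVec T
  sameLeaves⇒≡ {S = S} {T} = does⇒ (VecP.≡-dec FinP._≟_ (leafVec S) (leafVec T))

  ≡⇒sameLeaves : ∀ {s} {S T : Spider s} → leafVec S ≡ leafVec T → sameLeaves S T ≡ true
  ≡⇒sameLeaves {S = S} {T} = dec-true (VecP.≡-dec FinP._≟_ (leafVec S) (leafVec T))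

  sameLeaves-refl : ∀ {s} (S : Spider s) → sameLeaves S S ≡ true
  sameLeaves-refl S = ≡⇒sameLeaves {S = S} {S} refl

  sameLeaves-sym : ∀ {s} {S T : Spider s} → sameLeaves S T ≡ true → sameLeaves T S ≡ true
  sameLeaves-sym {S = S} {T} = ≡⇒sameLeaves {S = T} {S} ∘ ≡.sym ∘ sameLeaves⇒≡ {S = S} {T}

  sameLeaves-trans : ∀ {s} {S T U : Spider s} → sameLeaves S T ≡ true → sameLeaves T U ≡ true →
                     sameLeaves S U ≡ true
  sameLeaves-trans {S = S} {T} {U} S∼T T∼U =
    ≡⇒sameLeaves {S = S} {U} (trans (sameLeaves⇒≡ {S = S} {T} S∼T) (sameLeaves⇒≡ {S = T} {U} T∼U))

  sameLeaves-resp : ∀ {s} {S T : Spider s} U → sameLeaves S T ≡ true → sameLeaves S U ≡ sameLeaves T U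
  sameLeaves-resp {S = S} {T} U S∼T =
    cong (λ v → does (VecP.≡-dec FinP._≟_ v (leafVec U))) (sameLeaves⇒≡ {S = S} {T} S∼T)

  trim : List V → Bool → List V
  trim P g = if g then List.take (length P ∸ 1) P else P

  isPrefix-refl : ∀ (P : List V) → isPrefix P P ≡ true
  isPrefix-refl []      = refl
  isPrefix-refl (x ∷ P) rewrite dec-true (x FinP.≟ x) refl = isPrefix-refl P

  isPrefix-take : ∀ k (P : List V) → isPrefix (List.take k P) P ≡ true
  isPrefix-take zero    P       = refl
  isPrefix-take (suc k) []      = refl
  isPrefix-take (suc k) (x ∷ P) rewrite dec-true (x FinP.≟ x) refl = isPrefix-take k P

  shrink-⊑ : ∀ {s} (S : Spider s) γ → subspiderOf (shrink S γ) S ≡ true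
  shrink-⊑ (u , Ps) γ rewrite dec-true (u FinP.≟ u) refl = legs-prefix Ps γ
    where
    legs-prefix : ∀ {s} (Ps : Vec (List V) s) γ →
                  and (Vec.toList (Vec.zipWith isPrefix (Vec.zipWith trim Ps γ) Ps)) ≡ true
    legs-prefix []       []          = refl
    legs-prefix (P ∷ Ps) (true ∷ γ)  rewrite isPrefix-take (length P ∸ 1) P = legs-prefix Ps γ
    legs-prefix (P ∷ Ps) (false ∷ γ) rewrite isPrefix-refl P = legs-prefix Ps γ

  lengthVec-shrink : ∀ {s} (S : Spider s) γ → lengthVec (shrink S γ) ≡ lengthVec S ⊖ γ
  lengthVec-shrink (u , Ps) γ = go Ps γ
    where
    go : ∀ {s} (Ps : Vec (List V) s) γ → Vec.map length (Vec.zipWith trim Ps γ) ≡ Vec.map length Ps ⊖ γ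
    go []       []          = refl
    go (P ∷ Ps) (true ∷ γ)  =
      cong₂ _∷_ (trans (LP.length-take (length P ∸ 1) P) (ℕP.m≤n⇒m⊓n≡m (ℕP.m∸n≤m (length P) 1))) (go Ps γ)
    go (P ∷ Ps) (false ∷ γ) = cong (length P ∷_) (go Ps γ)

  candidates≡ : ∀ {s} (lv : Vec ℕ s) →
    concatMap (λ u → map (u ,_) (allListVecs n lv)) (allFin n) ≡ cartesianProduct (allFin n) (allListVecs n lv)
  candidates≡ lv = concatMap-map≡cartesianProductWith _,_ (allFin n) (allListVecs n lv)

  allSpiders-unique : ∀ {s} (lv : Vec ℕ s) → Unique (allSpiders lv)
  allSpiders-unique lv rewrite candidates≡ lv =
    UP.filter⁺ (T? ∘ validSpider) (UP.cartesianProduct⁺ (UP.allFin⁺ n) (allListVecs-unique lv))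

  ∈-allSpiders⁻ : ∀ {s} (lv : Vec ℕ s) {S} → S ∈ allSpiders lv → validSpider S ≡ true × lengthVec S ≡ lv
  ∈-allSpiders⁻ lv {S} S∈ rewrite candidates≡ lv
    with S∈candidates , valid ← ∈-filter⁻ (T? ∘ validSpider) {xs = cartesianProduct (allFin n) (allListVecs n lv)} S∈ =
    Equivalence.to BoolP.T-≡ valid ,
    ∈-allListVecs⁻ lv (proj₂ (∈-cartesianProduct⁻ (allFin n) (allListVecs n lv) S∈candidates))

  legsWalk : ∀ {s} → Spider s → Bool
  legsWalk (u , Ps) = allᵇ (λ P → walk (u ∷ P)) (Vec.toList Ps)

  -- Legs only have to be walks: this contains all shrunk spiders and is easy to count.
  walkSpiders : ∀ {s} → Vec ℕ s → List (Spider s)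
  walkSpiders lv = filterᵇ legsWalk (cartesianProduct (allFin n) (allListVecs n lv))

  walk-take : ∀ u k (P : List V) → walk (u ∷ P) ≡ true → walk (u ∷ List.take k P) ≡ true
  walk-take u zero    P       _    = refl
  walk-take u (suc k) []      _    = refl
  walk-take u (suc k) (x ∷ P) walk-uxP with Adj G u x
  ... | true = walk-take x k P walk-uxP

  legsWalk-shrink : ∀ {s} (S : Spider s) γ → legsWalk S ≡ true → legsWalk (shrink S γ) ≡ true
  legsWalk-shrink (u , Ps) γ = go Ps γ
    where
    go : ∀ {s} (Ps : Vec (List V) s) γ → allᵇ (λ P → walk (u ∷ P)) (Vec.toList Ps) ≡ true →
         allᵇ (λ P → walk (u ∷ P)) (Vec.toList (Vec.zipWith trim Ps γ)) ≡ true
    go []       []          _     = refl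
    go (P ∷ Ps) (g ∷ γ) walks with ∧-true {walk (u ∷ P)} walks
    go (P ∷ Ps) (true ∷ γ)  _ | walkP , walksPs
      rewrite walk-take u (length P ∸ 1) P walkP = go Ps γ walksPs
    go (P ∷ Ps) (false ∷ γ) _ | walkP , walksPs rewrite walkP = go Ps γ walksPs

  shrink∈walkSpiders : ∀ {s} {ls : Vec ℕ s} {S} → S ∈ allSpiders ls → ∀ γ → shrink S γ ∈ walkSpiders (ls ⊖ γ)
  shrink∈walkSpiders {ls = ls} {S@(u , Ps)} S∈ γ with valid , refl ← ∈-allSpiders⁻ ls S∈ =
    ∈-filter⁺ (T? ∘ legsWalk)
      (subst (λ lv → shrink S γ ∈ cartesianProduct (allFin n) (allListVecs n lv)) (lengthVec-shrink S γ)
        (∈-cartesianProduct⁺ (∈-allFin u) (∈-allListVecs⁺ (legs (shrink S γ)))))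
      (Equivalence.from BoolP.T-≡ (legsWalk-shrink S γ (proj₁ (∧-true {legsWalk S} valid))))

  module _ (D : ℕ) (degree≤D : ∀ v → degree G v ≤ D) where

    count-walks : ∀ u l → count (λ P → walk (u ∷ P)) (allLists n l) ≤ D ^ l
    count-walks u zero    = ℕP.≤-refl
    count-walks u (suc l) rewrite allLists-suc {n} l = begin
      count (λ P → walk (u ∷ P)) (cartesianProductWith _∷_ (allFin n) (allLists n l))
        ≡⟨ count-cartesianProductWith (λ P → walk (u ∷ P)) _∷_ (allFin n) (allLists n l) ⟩
      ∑ (λ x → count (λ P → Adj G u x ∧ walk (x ∷ P)) (allLists n l)) (allFin n)
        ≤⟨ ∑≤count* (Adj G u) (allFin n) (λ {x} _ → through x) ⟩
      degree G u * D ^ l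
        ≤⟨ ℕP.*-monoˡ-≤ (D ^ l) (degree≤D u) ⟩
      D * D ^ l ∎
      where
      open ℕP.≤-Reasoning
      through : ∀ x → count (λ P → Adj G u x ∧ walk (x ∷ P)) (allLists n l) ≤ (if Adj G u x then D ^ l else 0)
      through x with Adj G u x
      ... | true  = count-walks x l
      ... | false = ℕP.≤-reflexive (count-false (allLists n l))

    count-legWalks : ∀ u {s} (lv : Vec ℕ s) →
      count (λ Ps → allᵇ (λ P → walk (u ∷ P)) (Vec.toList Ps)) (allListVecs n lv) ≤ D ^ sumVec lv
    count-legWalks u []       = ℕP.≤-refl
    count-legWalks u (l ∷ lv) rewrite allListVecs-∷ {n} l lv = begin
      count legs-walk (cartesianProductWith _∷_ (allLists n l) (allListVecs n lv))
        ≡⟨ count-cartesianProductWith legs-walk _∷_ (allLists n l) (allListVecs n lv) ⟩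
      ∑ (λ P → count (λ Ps → walk (u ∷ P) ∧ legs-walk Ps) (allListVecs n lv)) (allLists n l)
        ≤⟨ ∑≤count* (λ P → walk (u ∷ P)) (allLists n l) (λ {P} _ → through P) ⟩
      count (λ P → walk (u ∷ P)) (allLists n l) * D ^ sumVec lv
        ≤⟨ ℕP.*-monoˡ-≤ (D ^ sumVec lv) (count-walks u l) ⟩
      D ^ l * D ^ sumVec lv
        ≡⟨ ℕP.^-distribˡ-+-* D l (sumVec lv) ⟨
      D ^ (l + sumVec lv) ∎
      where
      open ℕP.≤-Reasoning
      legs-walk : ∀ {s} → Vec (List V) s → Bool
      legs-walk Ps = allᵇ (λ P → walk (u ∷ P)) (Vec.toList Ps)
      through : ∀ P → count (λ Ps → walk (u ∷ P) ∧ legs-walk Ps) (allListVecs n lv)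
                        ≤ (if walk (u ∷ P) then D ^ sumVec lv else 0)
      through P with walk (u ∷ P)
      ... | true  = count-legWalks u lv
      ... | false = ℕP.≤-reflexive (count-false (allListVecs n lv))

    length-walkSpiders : ∀ {s} (lv : Vec ℕ s) → length (walkSpiders lv) ≤ n * D ^ sumVec lv
    length-walkSpiders lv = begin
      count legsWalk (cartesianProductWith _,_ (allFin n) (allListVecs n lv))
        ≡⟨ count-cartesianProductWith legsWalk _,_ (allFin n) (allListVecs n lv) ⟩
      ∑ (λ u → count (legsWalk ∘ (u ,_)) (allListVecs n lv)) (allFin n)
        ≤⟨ ∑≤length* (allFin n) (λ {u} _ → count-legWalks u lv) ⟩
      length (allFin n) * D ^ sumVec lv
        ≡⟨ cong (_* D ^ sumVec lv) (LP.length-tabulate {n = n} id) ⟩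
      n * D ^ sumVec lv ∎
      where open ℕP.≤-Reasoning

  -- goodSpider runs goodSpiderF with fuel ℓ, which unfolds only once ℓ is a successor.
  module BadSpiders {s} (ls : Vec ℕ s) {t} (ℓ≡ : sumVec ls ≡ suc t) where

    bad : Spider s → Bool
    bad S = admissibleSpider S ∧ not (goodSpider S)

    badSpiders : List (Spider s)
    badSpiders = filterᵇ bad (allSpiders ls)

    classSize : Spider s → ℕ
    classSize S = count (λ T → sameLeaves S T ∧ admissibleSpider T) (allSpiders ls)

    fits : Spider s → Bool
    fits S = ι (classSize S) ≤ᵇ f (sumVec ls) L

    totalLength-∈ : ∀ {S} → S ∈ allSpiders ls → totalLength S ≡ suc t
    totalLength-∈ S∈ = trans (cong sumVec (proj₂ (∈-allSpiders⁻ ls S∈))) ℓ≡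

    admSpiderF-∈ : ∀ {T} → T ∈ allSpiders ls → admSpiderF (suc t) T ≡ admissibleSpider T
    admSpiderF-∈ {T} T∈ = cong (λ m → admSpiderF m T) (≡.sym (totalLength-∈ T∈))

    goodSpider-∈ : ∀ {S} → S ∈ allSpiders ls → goodSpider S ≡ admissibleSpider S ∧ fits S
    goodSpider-∈ {S} S∈ = begin
      goodSpider S
        ≡⟨ cong (λ m → goodSpiderF m S) (totalLength-∈ S∈) ⟩
      admSpiderF (suc t) S ∧ (ι (count (λ T → sameLeaves S T ∧ admSpiderF (suc t) T) (allSpiders (lengthVec S)))
                               ≤ᵇ f (totalLength S) L)
        ≡⟨ cong₂ (λ a c → a ∧ (ι c ≤ᵇ f (totalLength S) L)) (admSpiderF-∈ S∈) classSize≡ ⟩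
      admissibleSpider S ∧ (ι (classSize S) ≤ᵇ f (totalLength S) L)
        ≡⟨ cong (λ m → admissibleSpider S ∧ (ι (classSize S) ≤ᵇ f m L)) (cong sumVec lv≡) ⟩
      admissibleSpider S ∧ fits S ∎
      where
      open ≡-Reasoning
      lv≡ = proj₂ (∈-allSpiders⁻ ls S∈)
      classSize≡ : count (λ T → sameLeaves S T ∧ admSpiderF (suc t) T) (allSpiders (lengthVec S)) ≡ classSize S
      classSize≡ = trans (cong (λ lv → count (λ T → sameLeaves S T ∧ admSpiderF (suc t) T) (allSpiders lv)) lv≡)
                         (count-cong (allSpiders ls) (λ {T} T∈ → cong (sameLeaves S T ∧_) (admSpiderF-∈ T∈)))

    bad-∈ : ∀ {S} → S ∈ allSpiders ls → bad S ≡ admissibleSpider S ∧ not (fits S)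
    bad-∈ {S} S∈ =
      trans (cong (λ g → admissibleSpider S ∧ not g) (goodSpider-∈ S∈)) (∧-not-∧ (admissibleSpider S) (fits S))

    classSize-resp : ∀ {S T} → sameLeaves S T ≡ true → classSize S ≡ classSize T
    classSize-resp {S} {T} S∼T =
      count-cong (allSpiders ls) (λ {U} _ → cong (_∧ admissibleSpider U) (sameLeaves-resp {S = S} {T} U S∼T))

    fits-resp : ∀ {S T} → sameLeaves S T ≡ true → fits S ≡ fits T
    fits-resp {S} {T} S∼T = cong (λ c → ι c ≤ᵇ f (sumVec ls) L) (classSize-resp {S} {T} S∼T)

    bad∧sameLeaves : ∀ {S T} → T ∈ allSpiders ls → fits S ≡ false →
                     bad T ∧ sameLeaves S T ≡ sameLeaves S T ∧ admissibleSpider T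
    bad∧sameLeaves {S} {T} T∈ overfull =
      trans (cong (_∧ sameLeaves S T) (bad-∈ T∈))
            (∧-not-∧-comm (admissibleSpider T) (fits T) (sameLeaves S T)
                          (λ S∼T → trans (≡.sym (fits-resp {S} {T} S∼T)) overfull))

    count-sameLeaves-bad : ∀ {S} → fits S ≡ false → count (sameLeaves S) badSpiders ≡ classSize S
    count-sameLeaves-bad {S} overfull =
      trans (count-filterᵇ bad (sameLeaves S) (allSpiders ls))
            (count-cong {p = λ T → bad T ∧ sameLeaves S T} {q = λ T → sameLeaves S T ∧ admissibleSpider T}
                        (allSpiders ls) (λ T∈ → bad∧sameLeaves {S} T∈ overfull))

    heavy : ∀ {S} → S ∈ badSpiders → f (sumVec ls) L <ℚ ι (count (sameLeaves S) badSpiders)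
    heavy {S} S∈bad = subst (λ c → f (sumVec ls) L <ℚ ι c) (≡.sym (count-sameLeaves-bad {S} overfull))
                        (ℚP.≰⇒> (λ fitting → subst T overfull (ℚP.≤⇒≤ᵇ fitting)))
      where
      S∈ = proj₁ (∈-filter⁻ (T? ∘ bad) {xs = allSpiders ls} S∈bad)
      badS = Equivalence.to BoolP.T-≡ (proj₂ (∈-filter⁻ (T? ∘ bad) {xs = allSpiders ls} S∈bad))
      overfull : fits S ≡ false
      overfull = BoolP.not-injective (proj₂ (∧-true {admissibleSpider S} (trans (≡.sym (bad-∈ S∈)) badS)))

  module Extraction {s} (ls : Vec ℕ s) {t} (ℓ≡ : sumVec ls ≡ suc t) (1≤ls : VecAll.All (1 ≤_) ls)
                    (δ D : ℕ) (degree≤D : ∀ v → degree G v ≤ D) (δ≤D : δ ≤ D) (0≤L : 0ℚ ≤ℚ L) where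
    open BadSpiders ls ℓ≡

    shrink∈pieces : ∀ {S} → S ∈ badSpiders → ∀ {γ} → γ ∈ allBits s → shrink S γ ∈ walkSpiders (ls ⊖ γ)
    shrink∈pieces {S} S∈bad {γ} _ =
      shrink∈walkSpiders {ls = ls} {S} (proj₁ (∈-filter⁻ (T? ∘ bad) {xs = allSpiders ls} S∈bad)) γ

    open Pruning badSpiders sameLeaves sameLeaves-refl (λ {S} {T} → sameLeaves-sym {S = S} {T})
                 (λ {S} {T} {U} → sameLeaves-trans {S = S} {T} {U}) (f (sumVec ls) L) heavy
                 (allBits s) shrink subspiderOf shrink-⊑ (λ γ → δ ^ bitSum γ) (L *ℚ L) (0≤* 0≤L 0≤L)
                 (λ γ → walkSpiders (ls ⊖ γ)) shrink∈pieces

    maxCoverage≤ : maxCoverage ≤ 2 ^ s * (n * D ^ sumVec ls)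
    maxCoverage≤ = begin
      ∑ (λ γ → δ ^ bitSum γ * length (walkSpiders (ls ⊖ γ))) (allBits s)
        ≤⟨ ∑≤length* (allBits s) (λ {γ} _ → piece-bound γ) ⟩
      length (allBits s) * (n * D ^ sumVec ls)
        ≡⟨ cong (_* (n * D ^ sumVec ls)) (length-allBits s) ⟩
      2 ^ s * (n * D ^ sumVec ls) ∎
      where
      open ℕP.≤-Reasoning
      piece-bound : ∀ γ → δ ^ bitSum γ * length (walkSpiders (ls ⊖ γ)) ≤ n * D ^ sumVec ls
      piece-bound γ = begin
        δ ^ bitSum γ * length (walkSpiders (ls ⊖ γ))
          ≤⟨ ℕP.*-mono-≤ (ℕP.^-monoˡ-≤ (bitSum γ) δ≤D) (length-walkSpiders D degree≤D (ls ⊖ γ)) ⟩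
        D ^ bitSum γ * (n * D ^ sumVec (ls ⊖ γ))  ≡⟨ ℕ*.x∙yz≈y∙xz (D ^ bitSum γ) n (D ^ sumVec (ls ⊖ γ)) ⟩
        n * (D ^ bitSum γ * D ^ sumVec (ls ⊖ γ))  ≡⟨ cong (n *_) (ℕP.^-distribˡ-+-* D (bitSum γ) (sumVec (ls ⊖ γ))) ⟨
        n * D ^ (bitSum γ + sumVec (ls ⊖ γ))      ≡⟨ cong (λ m → n * D ^ m) (bitSum+sumVec-⊖ ls γ 1≤ls) ⟩
        n * D ^ sumVec ls                         ∎

    module _ (p : Spider s → Bool) where

      kept-unique : Unique (kept p)
      kept-unique = UP.filter⁺ (T? ∘ p) (UP.filter⁺ (T? ∘ bad) (allSpiders-unique ls))

      kept-members : All (λ S → lengthVec S ≡ ls × admissibleSpider S ≡ true) (kept p)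
      kept-members = All.tabulate λ {S} S∈kept →
        let S∈bad = proj₁ (∈-filter⁻ (T? ∘ p) {xs = badSpiders} S∈kept)
            S∈ , badS = ∈-filter⁻ (T? ∘ bad) {xs = allSpiders ls} S∈bad
        in proj₂ (∈-allSpiders⁻ ls S∈) , proj₁ (∧-true {admissibleSpider S} (Equivalence.to BoolP.T-≡ badS))

      kept-classes : All (Balanced p) (kept p) →
                     ∀ S → S ∈ kept p → f (sumVec ls) L ≤ℚ ι 2 *ℚ ι (count (sameLeaves S) (kept p))
      kept-classes balanced S S∈kept = proj₁ (All.lookup balanced S∈kept)

      kept-pieces : All (Balanced p) (kept p) → ∀ S → S ∈ kept p → (γ : Vec Bool s) →
                    ι δ ^ℚ bitSum γ ≤ℚ (L *ℚ L) *ℚ ι (count (subspiderOf (shrink S γ)) (kept p))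
      kept-pieces balanced S S∈kept γ =
        subst (_≤ℚ (L *ℚ L) *ℚ ι (count (subspiderOf (shrink S γ)) (kept p))) (ι-^ δ (bitSum γ))
              (All.lookup (proj₂ (All.lookup balanced S∈kept)) (∈-allBits γ))

      kept≢[] : ∀ {K m} → 1ℚ ≤ℚ K → sumVec ls ≤ m → ι D ≤ℚ K *ℚ ι δ → 0 < n * δ ^ sumVec ls →
                threshold s m K <ℚ L →
                ι n *ℚ ι δ ^ℚ sumVec ls ≤ℚ L *ℚ ι (length badSpiders) →
                (L *ℚ L) *ℚ ι (count (not ∘ p) badSpiders) ≤ℚ ι (2 * maxCoverage) → kept p ≢ []
      kept≢[] {K} {m} 1≤K ℓ≤m D≤Kδ 0<nδ^ℓ C<L many-bad pruned empty = ℚP.<-irrefl refl (ℚP.<-≤-trans C<L L≤C)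
        where
        open ℚP.≤-Reasoning
        removed≡all : count (not ∘ p) badSpiders ≡ length badSpiders
        removed≡all = trans (cong (_+ count (not ∘ p) badSpiders) (≡.sym (cong length empty)))
                            (count+count-not≡length p badSpiders)
        everything-removed : L *ℚ L *ℚ ι (length badSpiders) ≤ℚ threshold s m K *ℚ (ι n *ℚ ι δ ^ℚ sumVec ls)
        everything-removed = begin
          L *ℚ L *ℚ ι (length badSpiders)               ≡⟨ cong (λ x → L *ℚ L *ℚ ι x) removed≡all ⟨
          L *ℚ L *ℚ ι (count (not ∘ p) badSpiders)      ≤⟨ pruned ⟩
          ι (2 * maxCoverage)                           ≤⟨ ι-mono-≤ (ℕP.*-monoʳ-≤ 2 maxCoverage≤) ⟩
          ι (2 * (2 ^ s * (n * D ^ sumVec ls)))         ≡⟨ cong ι (ℕP.*-assoc 2 (2 ^ s) (n * D ^ sumVec ls)) ⟨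
          ι (2 * 2 ^ s * (n * D ^ sumVec ls))
            ≤⟨ ι-*-^-≤-scaled (2 * 2 ^ s) n {K} {D} {δ} (sumVec ls) D≤Kδ 1≤K ℓ≤m ⟩
          threshold s m K *ℚ (ι n *ℚ ι δ ^ℚ sumVec ls)  ∎
        0<ι[nδ^ℓ] : 0ℚ <ℚ ι n *ℚ ι δ ^ℚ sumVec ls
        0<ι[nδ^ℓ] = subst (0ℚ <ℚ_) (trans (ι-* n (δ ^ sumVec ls)) (cong (ι n *ℚ_) (ι-^ δ (sumVec ls)))) (0<ι 0<nδ^ℓ)
        L≤C : L ≤ℚ threshold s m K
        L≤C = square-cancel-≤ (length badSpiders) (ℚP.≤-<-trans (0≤threshold s m 1≤K) C<L)
                (0<-of-≤-*ι {L = L} (length badSpiders) 0<ι[nδ^ℓ] many-bad) (0≤threshold s m 1≤K)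
                many-bad everything-removed

    Conclusion : Set
    Conclusion = Σ (List (Spider s)) λ 𝒮 →
      (𝒮 ≢ []) × Unique 𝒮 ×
      All (λ S → lengthVec S ≡ ls × admissibleSpider S ≡ true) 𝒮 ×
      (∀ S → S ∈ 𝒮 → f (sumVec ls) L ≤ℚ ι 2 *ℚ ι (count (sameLeaves S) 𝒮)) ×
      (∀ S → S ∈ 𝒮 → (γ : Vec Bool s) →
        ι δ ^ℚ bitSum γ ≤ℚ (L *ℚ L) *ℚ ι (count (subspiderOf (shrink S γ)) 𝒮))

    conclusion : ∀ {K m} → 1ℚ ≤ℚ K → sumVec ls ≤ m → ι D ≤ℚ K *ℚ ι δ → 0 < n * δ ^ sumVec ls →
      threshold s m K <ℚ L → ι n *ℚ ι δ ^ℚ sumVec ls ≤ℚ L *ℚ ι (length badSpiders) → Conclusion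
    conclusion 1≤K ℓ≤m D≤Kδ 0<nδ^ℓ C<L many-bad = from prune
      where
      from : Pruned → Conclusion
      from (p , balanced , pruned) =
        kept p , kept≢[] p 1≤K ℓ≤m D≤Kδ 0<nδ^ℓ C<L many-bad pruned , kept-unique p , kept-members p ,
        kept-classes p balanced , kept-pieces p balanced


sumVec≡suc : ∀ {s} (ls : Vec ℕ s) → 1 ≤ s → VecAll.All (1 ≤_) ls → ∃[ t ] sumVec ls ≡ suc t
sumVec≡suc (suc l ∷ ls) _ _         = l + sumVec ls , refl
sumVec≡suc (zero ∷ ls)  _ (() ∷ _)

sumVec≤* : ∀ {s k} (ls : Vec ℕ s) → VecAll.All (_≤ k) ls → sumVec ls ≤ s * k
sumVec≤* []       []           = z≤n
sumVec≤* (l ∷ ls) (l≤k ∷ ls≤k) = ℕP.+-mono-≤ l≤k (sumVec≤* ls ls≤k)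

0<*^ : ∀ {n δ} → Fin n → 1 ≤ δ → ∀ ℓ → 0 < n * δ ^ ℓ
0<*^ {suc n} {suc δ} _ _ ℓ = ℕP.*-mono-≤ {1} {suc n} (s≤s z≤n) (ℕP.m^n>0 (suc δ) ℓ)

lemma3p2 : (s k : ℕ) → 2 ≤ s → 2 ≤ k → (K : ℚ) → ι 1 ≤ℚ K →
    ∃[ L₀ ] ∀ (L : ℚ) → L₀ ≤ℚ L →
    (ls : Vec ℕ s) → VecAll.All (λ l → 1 ≤ l × l ≤ k) ls →
    (n : ℕ) (G : SimpleGraph n) (δ : ℕ) →
    -- δ is the minimum degree of G (in particular n ≥ 1)
    (∀ v → δ ≤ degree G v) → (∃[ v ] degree G v ≡ δ) →
    1 ≤ δ →
    -- G is K-almost-regular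
    (∀ v → ι (degree G v) ≤ℚ K *ℚ ι δ) →
    let open Notions G L in
    -- at least n δ^ℓ / L admissible-but-not-good spiders with length vector ls
    ι n *ℚ (ι δ ^ℚ sumVec ls)
      ≤ℚ L *ℚ ι (count (λ S → admissibleSpider S ∧ not (goodSpider S)) (allSpiders ls)) →
    Σ (List (Spider s)) λ 𝒮 →
      (𝒮 ≢ []) × Unique 𝒮 ×
      All (λ S → lengthVec S ≡ ls × admissibleSpider S ≡ true) 𝒮 ×
      -- (i)
      (∀ S → S ∈ 𝒮 → f (sumVec ls) L ≤ℚ ι 2 *ℚ ι (count (sameLeaves S) 𝒮)) ×
      -- (ii)
      (∀ S → S ∈ 𝒮 → (γ : Vec Bool s) →
        ι δ ^ℚ bitSum γ ≤ℚ (L *ℚ L) *ℚ ι (count (subspiderOf (shrink S γ)) 𝒮))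
lemma3p2 s k 2≤s _ K 1≤K = threshold s (s * k) K +ℚ 1ℚ ,
  λ L L₀≤L ls ls-range n G δ δ≤degree (v₀ , _) 1≤δ almost-regular many-bad →
    let C<L = ℚP.<-≤-trans (p<p+1 (threshold s (s * k) K)) L₀≤L
        t , ℓ≡ = sumVec≡suc ls (ℕP.≤-trans (s≤s z≤n) 2≤s) (VecAll.map proj₁ ls-range)
        vmax = argmax (degree G) v₀ (allFin n)
        degree≤max : ∀ v → degree G v ≤ degree G vmax
        degree≤max v = All.lookup (f[xs]≤f[argmax] {f = degree G} v₀ (allFin n)) (∈-allFin v)
        open SpiderFacts G L
        open Extraction ls ℓ≡ (VecAll.map proj₁ ls-range) δ (degree G vmax) degree≤max (δ≤degree vmax)
                        (ℚP.<⇒≤ (ℚP.≤-<-trans (0≤threshold s (s * k) 1≤K) C<L))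
    in conclusion 1≤K (sumVec≤* ls (VecAll.map proj₂ ls-range)) (almost-regular vmax) (0<*^ v₀ 1≤δ (sumVec ls))
                  C<L many-bad
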